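{- Let $k\ge 1$. The map $$I\mapsto f(I)=f_L(I\cap L)\ \cup\ \bigl(Q^-\setminus f_R(I\cap R)\bigr)$$ is a bijection between the set of order ideals $I$ of $P'$ such that there is no $1\le x_0\le k$ with $l_{x_0},r_{x_0}\in I$ and no $1\le x_1<k$ with $r_{x_1},l_{x_1+1}\in I$, and the set of balanced order ideals of $Q$.
   Context: $\mathbb{N}$ denotes the non-negative integers. Let $F=(2k+1)(2k+3)-(2k+1)-(2k+3)$ and $P'=\{(a,b)\in\mathbb{N}^2\mid (2k+1)a+(2k+3)b\le F\}$, with partial order $(a_1,b_1)\le(a_0,b_0)$ iff $a_0\le a_1$ and $b_0\le b_1$. Let $L=\{(a,b)\in P'\mid a>b,\ a+b\le 2k\}$, $R=\{(a,b)\in P'\mid a\le b,\ a+b\le 2k-1\}$. For $1\le i\le k$, $l_i=(k+i,k-i)$ and $r_i=(i-1,2k-i)$. Let $Q=\{(a,b)\in\mathbb{Z}^2\mid 1\le a-b\le 2k+2\}$, partially ordered as the reflexive-transitive closure of $(a,b)\ge(a+1,b)$ and $(a,b)\ge(a,b+1)$; let $Q^+=\{(a,b)\in Q\mid a+b\le 2k\}$ and $Q^-=\{(a,b)\in Q\mid a+b\ge 2k+1\}$. Define $f_L:L\to Q^+$ by $f_L(a,b)=(a,b)$ and $f_R:R\to Q^-$ by $f_R(a,b)=(3k+1-b,\,k-1-a)$. An order ideal of a poset is a subset $J$ with $y\in J$, $x\le y\Rightarrow x\in J$. For a proper ($J\ne Q$), non-empty order ideal $J$ of $Q$ and $0\le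 p\le 2k+1$, the height $h_J(p)$ is the maximum of $2k+1-a-b$ over $(a,b)\in J$ with $a-b=2k+2-p$. Such $J$ is balanced if $h_J(0)<0$, $h_J(2k+1)\ge 0$, and $|h_J(0)+h_J(2k+1)|=1$. -}

module Defs where

open import Data.Nat as ℕ using (ℕ; suc)
open import Data.Integer as ℤ using (ℤ; +_; ∣_∣)
open import Data.Bool using (Bool; true; false)
open import Data.Product using (_×_; _,_; Σ; ∃; ∃-syntax)
open import Data.Sum using (_⊎_)
open import Relation.Nullary using (¬_)
open import Relation.Binary.PropositionalEquality using (_≡_)
open import Relation.Binary.Construct.Closure.ReflexiveTransitive using (Star)

ℕ² : Set
ℕ² = ℕ × ℕ

ℤ² : Set
ℤ² = ℤ × ℤ

module _ (k : ℕ) where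

  Frob : ℕ
  Frob = (2 ℕ.* k ℕ.+ 1) ℕ.* (2 ℕ.* k ℕ.+ 3) ℕ.∸ (2 ℕ.* k ℕ.+ 1) ℕ.∸ (2 ℕ.* k ℕ.+ 3)

  InP' : ℕ² → Set
  InP' (a , b) = (2 ℕ.* k ℕ.+ 1) ℕ.* a ℕ.+ (2 ℕ.* k ℕ.+ 3) ℕ.* b ℕ.≤ Frob

  _≤P_ : ℕ² → ℕ² → Set
  (a₁ , b₁) ≤P (a₀ , b₀) = (a₀ ℕ.≤ a₁) × (b₀ ℕ.≤ b₁)

  InL : ℕ² → Set
  InL (a , b) = InP' (a , b) × (b ℕ.< a) × (a ℕ.+ b ℕ.≤ 2 ℕ.* k)

  InR : ℕ² → Set
  InR (a , b) = InP' (a , b) × (a ℕ.≤ b) × (a ℕ.+ b ℕ.≤ 2 ℕ.* k ℕ.∸ 1)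

  l : ℕ → ℕ²
  l i = (k ℕ.+ i , k ℕ.∸ i)

  r : ℕ → ℕ²
  r i = (i ℕ.∸ 1 , 2 ℕ.* k ℕ.∸ i)

  IsIdealP' : (ℕ² → Bool) → Set
  IsIdealP' I = (∀ x → I x ≡ true → InP' x)
              × (∀ x y → InP' x → InP' y → I y ≡ true → x ≤P y → I x ≡ true)

  Admissible : (ℕ² → Bool) → Set
  Admissible I = IsIdealP' I
               × (∀ x₀ → 1 ℕ.≤ x₀ → x₀ ℕ.≤ k → ¬ (I (l x₀) ≡ true × I (r x₀) ≡ true))
               × (∀ x₁ → 1 ℕ.≤ x₁ → x₁ ℕ.< k → ¬ (I (r x₁) ≡ true × I (l (suc x₁)) ≡ true))

  InQ : ℤ² → Set
  InQ (a , b) = (+ 1 ℤ.≤ a ℤ.- b) × (a ℤ.- b ℤ.≤ + (2 ℕ.* k ℕ.+ 2))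

  InQ⁺ : ℤ² → Set
  InQ⁺ (a , b) = InQ (a , b) × (a ℤ.+ b ℤ.≤ + (2 ℕ.* k))

  InQ⁻ : ℤ² → Set
  InQ⁻ (a , b) = InQ (a , b) × (+ (2 ℕ.* k ℕ.+ 1) ℤ.≤ a ℤ.+ b)

  data QStep : ℤ² → ℤ² → Set where
    stepA : ∀ a b → InQ (a , b) → InQ (a ℤ.+ + 1 , b) → QStep (a ℤ.+ + 1 , b) (a , b)
    stepB : ∀ a b → InQ (a , b) → InQ (a , b ℤ.+ + 1) → QStep (a , b ℤ.+ + 1) (a , b)

  _≤Q_ : ℤ² → ℤ² → Set
  x ≤Q y = Star QStep x y

  IsIdealQ : (ℤ² → Bool) → Set
  IsIdealQ J = (∀ q → J q ≡ true → InQ q)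
             × (∀ x y → InQ x → InQ y → J y ≡ true → x ≤Q y → J x ≡ true)

  HeightIs : (ℤ² → Bool) → ℕ → ℤ → Set
  HeightIs J p h =
      (∃[ q ] (J q ≡ true × Diag q × (hgt q ≡ h)))
    × (∀ q → J q ≡ true → Diag q → hgt q ℤ.≤ h)
    where
      Diag : ℤ² → Set
      Diag (a , b) = a ℤ.- b ≡ + (2 ℕ.* k ℕ.+ 2) ℤ.- + p
      hgt : ℤ² → ℤ
      hgt (a , b) = + (2 ℕ.* k ℕ.+ 1) ℤ.- a ℤ.- b

  IsBalanced : (ℤ² → Bool) → Set
  IsBalanced J = IsIdealQ J
               × (∃[ q ] (InQ q × J q ≡ false))
               × (∃[ q ] (J q ≡ true))
               × (∃[ h₀ ] ∃[ h₁ ] (HeightIs J 0 h₀ × HeightIs J (2 ℕ.* k ℕ.+ 1) h₁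
                                  × (h₀ ℤ.< + 0) × (+ 0 ℤ.≤ h₁) × (∣ h₀ ℤ.+ h₁ ∣ ≡ 1)))

  fL : ℕ² → ℤ²
  fL (a , b) = (+ a , + b)

  fR : ℕ² → ℤ²
  fR (a , b) = (+ (3 ℕ.* k ℕ.+ 1) ℤ.- + b , + k ℤ.- + 1 ℤ.- + a)

  _∈f[_] : ℤ² → (ℕ² → Bool) → Set
  q ∈f[ I ] = (∃[ x ] (InL x × I x ≡ true × fL x ≡ q))
            ⊎ (InQ⁻ q × ¬ (∃[ x ] (InR x × I x ≡ true × fR x ≡ q)))

  Represents : (ℕ² → Bool) → (ℤ² → Bool) → Set
  Represents I J = ∀ q → (J q ≡ true → q ∈f[ I ]) × (q ∈f[ I ] → J q ≡ true)

-- P' splits as L ⊔ R (this is where the Frobenius bound enters). f_L is the identity from L onto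
-- ℕ² ∩ Q⁺, and f_R is an order-reversing bijection from R onto the part of Q⁻ below the line b = k,
-- the part above that line lying in every f(I). So f(I) is an ideal of Q except possibly across the
-- antidiagonal a + b = 2k, where the covers of l i are f_R(r i) and f_R(r (i - 1)): precisely the
-- pairs that admissibility excludes.
-- On the two boundary diagonals f(I) is cut off at thresholds: if γ and δ are the least c with
-- (c , c) ∈ I, resp. (c + 1 , c) ∈ I, then h(0) = -1 - 2(k - γ) and h(2k+1) = 2(k - δ), and the ideal
-- property of I gives δ ≤ γ ≤ δ + 1, i.e. |h(0) + h(2k+1)| = 1. Conversely, the thresholds B₀, B₁ of a
-- balanced J satisfy B₀ + B₁ ∈ {k - 1, k}, and this makes I = f_L⁻¹(J) ∪ (R ∖ f_R⁻¹(J)) an admissible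
-- ideal with f(I) = J. Injectivity holds as f_L and f_R are injective with disjoint images.

module Submission where

open import Defs
open import Data.Nat using (ℕ; _≤_)
open import Data.Bool using (Bool)
open import Data.Product using (_×_; ∃-syntax)
open import Relation.Binary.PropositionalEquality using (_≡_)

open import Data.Nat using (zero; suc; z≤n; s≤s; _<_; _+_; _*_; _∸_; _<?_; _≤?_; >-nonZero)
open import Data.Nat.Properties
open import Data.Nat.Tactic.RingSolver using (solve-∀)
open import Data.Integer as ℤ using (ℤ; +_; -[1+_]; _⊖_; ∣_∣)
import Data.Integer.Properties as ℤₚ
import Data.Integer.Tactic.RingSolver as ℤ-Solver
open import Data.Bool using (true; false; not) renaming (_≟_ to _≟ᵇ_)
open import Data.Bool.Properties using (¬-not; ⇔→≡; not-involutive)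
open import Data.Empty using (⊥; ⊥-elim)
open import Data.Product using (_,_; proj₁; proj₂)
open import Data.Product.Properties using (≡-dec)
open import Data.Sum using (_⊎_; inj₁; inj₂; [_,_]′)
open import Function.Base using (_∘_)
open import Function.Bundles using (_⇔_; mk⇔; Equivalence)
open import Function.Properties.Equivalence using () renaming (trans to ⇔-trans; sym to ⇔-sym)
open import Relation.Nullary using (¬_; Dec; yes; no; does; contradiction)
open import Relation.Nullary.Decidable using (_×-dec_; _⊎-dec_; ¬?)
open import Relation.Binary.Definitions using (DecidableEquality)
open import Relation.Binary.PropositionalEquality
  using (_≢_; refl; sym; trans; cong; cong₂; subst; subst₂; module ≡-Reasoning)
open import Relation.Binary.Construct.Closure.ReflexiveTransitive using (ε; _◅_; _◅◅_)

open Equivalence using (to; from)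

preimage? : {A B : Set} {P Q : A → Set} (f : A → B) (g : B → A) → (∀ x → g (f x) ≡ x) →
            DecidableEquality B → (∀ x → Dec (P x)) → (∀ x → Dec (Q x)) →
            ∀ y → Dec (∃[ x ] (P x × Q x × f x ≡ y))
preimage? {P = P} {Q} f g g∘f _≟_ P? Q? y with P? (g y) | Q? (g y) | f (g y) ≟ y
... | yes p | yes q | yes e = yes (g y , p , q , e)
... | no ¬p | _     | _     = no λ { (x , p , _ , refl) → ¬p (subst P (sym (g∘f x)) p) }
... | yes _ | no ¬q | _     = no λ { (x , _ , q , refl) → ¬q (subst Q (sym (g∘f x)) q) }
... | yes _ | yes _ | no ¬e = no λ { (x , _ , _ , refl) → ¬e (cong f (g∘f x)) }

does≡true⇔ : {P : Set} (P? : Dec P) → does P? ≡ true ⇔ P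
does≡true⇔ (yes p) = mk⇔ (λ _ → p) (λ _ → refl)
does≡true⇔ (no ¬p) = mk⇔ (λ ()) (λ p → contradiction p ¬p)

threshold : ∀ N (p : ℕ → Bool) → (∀ c → suc c < N → p c ≡ true → p (suc c) ≡ true) →
            ∃[ γ ] (γ ≤ N × (∀ c → c < N → (p c ≡ true ⇔ γ ≤ c)))
threshold zero p mono = 0 , z≤n , λ c ()
threshold (suc N) p mono with threshold N p (λ c c+1<N → mono c (m<n⇒m<1+n c+1<N)) | p N in pN
... | γ , γ≤N , char | true = γ , m≤n⇒m≤1+n γ≤N , char′
  where
  char′ : ∀ c → c < suc N → (p c ≡ true ⇔ γ ≤ c)
  char′ c c<1+N with m<1+n⇒m<n∨m≡n c<1+N
  ... | inj₁ c<N  = char c c<N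
  ... | inj₂ refl = mk⇔ (λ _ → γ≤N) (λ _ → pN)
... | γ , γ≤N , char | false = suc N , ≤-refl , char′
  where
  pN-true : ∀ {c} → c < N → p c ≡ true → p N ≡ true
  pN-true {c} (s≤s {n = N′} c≤N′) pc = mono N′ ≤-refl (from (char N′ ≤-refl) (≤-trans (to (char c (s≤s c≤N′)) pc) c≤N′))
  char′ : ∀ c → c < suc N → (p c ≡ true ⇔ suc N ≤ c)
  char′ c c<1+N with m<1+n⇒m<n∨m≡n c<1+N
  ... | inj₁ c<N  = mk⇔ (λ pc → contradiction (trans (sym (pN-true c<N pc)) pN) λ ())
                        (λ N<c → contradiction (<-trans N<c c<N) (<-irrefl refl))
  ... | inj₂ refl = mk⇔ (λ pc → contradiction (trans (sym pc) pN) λ ()) (λ N<N → contradiction N<N (<-irrefl refl))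

m+n≡o+p⇒o≤m⇔n≤p : ∀ {m n o p} → m + n ≡ o + p → (o ≤ m ⇔ n ≤ p)
m+n≡o+p⇒o≤m⇔n≤p {m} {n} {o} {p} e = mk⇔
  (λ o≤m → +-cancelˡ-≤ o n p (≤-trans (+-monoˡ-≤ n o≤m) (≤-reflexive e)))
  (λ n≤p → +-cancelʳ-≤ n o m (≤-trans (+-monoʳ-≤ o n≤p) (≤-reflexive (sym e))))

m+d+m≤n+d+n⇔m≤n : ∀ {m n d} → (m + d + m ≤ n + d + n) ⇔ (m ≤ n)
m+d+m≤n+d+n⇔m≤n {d = d} = mk⇔
  (λ le → ≮⇒≥ λ n<m → <⇒≱ (+-mono-< (+-monoˡ-< d n<m) n<m) le)
  (λ m≤n → +-mono-≤ (+-monoˡ-≤ d m≤n) m≤n)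

∣m⊖n∣≡1⇔ : ∀ {m n} → ∣ m ⊖ n ∣ ≡ 1 ⇔ (m ≡ suc n ⊎ n ≡ suc m)
∣m⊖n∣≡1⇔ {m} {n} = mk⇔ to′ from′
  where
  to′ : ∣ m ⊖ n ∣ ≡ 1 → m ≡ suc n ⊎ n ≡ suc m
  to′ e with ≤-total n m
  ... | inj₁ n≤m = inj₁ (trans (sym (m∸n+n≡m n≤m)) (cong (_+ n) (trans (sym (cong ∣_∣ (ℤₚ.⊖-≥ n≤m))) e)))
  ... | inj₂ m≤n = inj₂ (trans (sym (m∸n+n≡m m≤n)) (cong (_+ m) (trans (sym (ℤₚ.∣⊖∣-≤ m≤n)) e)))
  from′ : m ≡ suc n ⊎ n ≡ suc m → ∣ m ⊖ n ∣ ≡ 1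
  from′ (inj₁ refl) = trans (cong ∣_∣ (ℤₚ.⊖-≥ (n≤1+n n))) (m+n∸n≡m 1 n)
  from′ (inj₂ refl) = trans (ℤₚ.∣⊖∣-≤ (n≤1+n m)) (m+n∸n≡m 1 m)

private
  x-y+y≡x : ∀ x y → x ℤ.- y ℤ.+ y ≡ x
  x-y+y≡x = ℤ-Solver.solve-∀

  x+y-y≡x : ∀ x y → x ℤ.+ y ℤ.- y ≡ x
  x+y-y≡x = ℤ-Solver.solve-∀

  x+y-x≡y : ∀ x y → x ℤ.+ y ℤ.- x ≡ y
  x+y-x≡y = ℤ-Solver.solve-∀

  x-[x-y]≡y : ∀ x y → x ℤ.- (x ℤ.- y) ≡ y
  x-[x-y]≡y = ℤ-Solver.solve-∀

  x-y-z≡x-[y+z] : ∀ x y z → x ℤ.- y ℤ.- z ≡ x ℤ.- (y ℤ.+ z)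
  x-y-z≡x-[y+z] = ℤ-Solver.solve-∀

  [x+1]-y≡[x-y]+1 : ∀ x y → x ℤ.+ + 1 ℤ.- y ≡ (x ℤ.- y) ℤ.+ + 1
  [x+1]-y≡[x-y]+1 = ℤ-Solver.solve-∀

  x-[y+1]≡[x-y]-1 : ∀ x y → x ℤ.- (y ℤ.+ + 1) ≡ (x ℤ.- y) ℤ.- + 1
  x-[y+1]≡[x-y]-1 = ℤ-Solver.solve-∀

  x-[1+y]≡x-y-1 : ∀ x y → x ℤ.- (+ 1 ℤ.+ y) ≡ x ℤ.- y ℤ.- + 1
  x-[1+y]≡x-y-1 = ℤ-Solver.solve-∀

  x+1-1≡x : ∀ x → x ℤ.+ + 1 ℤ.- + 1 ≡ x
  x+1-1≡x = ℤ-Solver.solve-∀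

  x+[y+y]≡[x+y]+y : ∀ x y → x ℤ.+ (y ℤ.+ y) ≡ x ℤ.+ y ℤ.+ y
  x+[y+y]≡[x+y]+y = ℤ-Solver.solve-∀

  i≤i+1 : ∀ i → i ℤ.≤ i ℤ.+ + 1
  i≤i+1 i = ℤₚ.≤-trans (ℤₚ.≤-reflexive (sym (ℤₚ.+-identityʳ i))) (ℤₚ.+-monoʳ-≤ i (ℤ.+≤+ z≤n))

  2k≡k+k : ∀ k → 2 * k ≡ k + k
  2k≡k+k = solve-∀

[+m]-[+n]≡+o⇒m≡o+n : ∀ {m n o} → + m ℤ.- + n ≡ + o → m ≡ o + n
[+m]-[+n]≡+o⇒m≡o+n {m} {n} {o} e = ℤₚ.+-injective (begin
  + m                   ≡⟨ sym (x-y+y≡x (+ m) (+ n)) ⟩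
  + m ℤ.- + n ℤ.+ + n   ≡⟨ cong (ℤ._+ + n) e ⟩
  + (o + n)             ∎)
  where open ≡-Reasoning

m≡o+n⇒[+m]-[+n]≡+o : ∀ {m n o} → m ≡ o + n → + m ℤ.- + n ≡ + o
m≡o+n⇒[+m]-[+n]≡+o {n = n} {o} refl = x+y-y≡x (+ o) (+ n)

+o≤[+m]-[+n]⇔o+n≤m : ∀ {m n o} → (+ o ℤ.≤ + m ℤ.- + n) ⇔ (o + n ≤ m)
+o≤[+m]-[+n]⇔o+n≤m {m} {n} {o} = mk⇔
  (λ le → ℤₚ.drop‿+≤+ (subst (+ (o + n) ℤ.≤_) (x-y+y≡x (+ m) (+ n)) (ℤₚ.+-monoˡ-≤ (+ n) le)))
  (λ le → subst (ℤ._≤ + m ℤ.- + n) (x+y-y≡x (+ o) (+ n)) (ℤₚ.+-monoˡ-≤ (ℤ.- + n) (ℤ.+≤+ le)))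

[+m]-[+n]≤+o⇔m≤o+n : ∀ {m n o} → (+ m ℤ.- + n ℤ.≤ + o) ⇔ (m ≤ o + n)
[+m]-[+n]≤+o⇔m≤o+n {m} {n} {o} = mk⇔
  (λ le → ℤₚ.drop‿+≤+ (subst (ℤ._≤ + (o + n)) (x-y+y≡x (+ m) (+ n)) (ℤₚ.+-monoˡ-≤ (+ n) le)))
  (λ le → subst (+ m ℤ.- + n ℤ.≤_) (x+y-y≡x (+ o) (+ n)) (ℤₚ.+-monoˡ-≤ (ℤ.- + n) (ℤ.+≤+ le)))

≤⇒∃+ : ∀ {x y} → x ℤ.≤ y → ∃[ i ] (x ℤ.+ + i ≡ y)
≤⇒∃+ {x} {y} x≤y = ∣ y ℤ.- x ∣ ,
  trans (cong (λ z → x ℤ.+ z) (ℤₚ.0≤i⇒+∣i∣≡i (ℤₚ.i≤j⇒0≤j-i x≤y))) (x+[y-x]≡y x y)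
  where
  x+[y-x]≡y : ∀ x y → x ℤ.+ (y ℤ.- x) ≡ y
  x+[y-x]≡y = ℤ-Solver.solve-∀

2+Frob≡[2k+1]² : ∀ {k} → 1 ≤ k → 2 + Frob k ≡ (2 * k + 1) * (2 * k + 1)
2+Frob≡[2k+1]² (s≤s {n = n} z≤n) = begin
  2 + (A * B ∸ A ∸ B)              ≡⟨ cong (λ w → 2 + (w ∸ A ∸ B)) (product n) ⟩
  2 + ((X + B) + A ∸ A ∸ B)        ≡⟨ cong (λ w → 2 + (w ∸ B)) (m+n∸n≡m (X + B) A) ⟩
  2 + (X + B ∸ B)                  ≡⟨ cong (_+_ 2) (m+n∸n≡m X B) ⟩
  2 + X                            ≡⟨ square n ⟩
  A * A                            ∎
  where
  open ≡-Reasoning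
  A = 2 * suc n + 1
  B = 2 * suc n + 3
  X = 4 * n * n + 12 * n + 7
  product : ∀ n → (2 * suc n + 1) * (2 * suc n + 3) ≡ (4 * n * n + 12 * n + 7 + (2 * suc n + 3)) + (2 * suc n + 1)
  product = solve-∀
  square : ∀ n → 2 + (4 * n * n + 12 * n + 7) ≡ (2 * suc n + 1) * (2 * suc n + 1)
  square = solve-∀

module _ (k : ℕ) where

  InQ⇔ : ∀ a b {d} → a ℤ.- b ≡ + d → InQ k (a , b) ⇔ (1 ≤ d × d ≤ 2 * k + 2)
  InQ⇔ _ _ e = mk⇔ (λ (lo , hi) → ℤₚ.drop‿+≤+ (subst (+ 1 ℤ.≤_) e lo) , ℤₚ.drop‿+≤+ (subst (ℤ._≤ + _) e hi))
               (λ (lo , hi) → subst (+ 1 ℤ.≤_) (sym e) (ℤ.+≤+ lo) , subst (ℤ._≤ + _) (sym e) (ℤ.+≤+ hi))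

  InQ⇒diff : ∀ a b → InQ k (a , b) → ∃[ d ] (a ℤ.- b ≡ + d)
  InQ⇒diff _ _ (lo , _) = _ , sym (ℤₚ.0≤i⇒+∣i∣≡i (ℤₚ.≤-trans (ℤ.+≤+ z≤n) lo))

  -- Greedy descent: raise a while the difference a - b stays below 2k+2, otherwise raise b.
  descend : ∀ i j {a b d} → a ℤ.- b ≡ + d → 1 ≤ d → d ≤ 2 * k + 2 →
            suc j ≤ d + i → d + i ≤ 2 * k + 2 + j → _≤Q_ k (a ℤ.+ + i , b ℤ.+ + j) (a , b)
  descend zero zero {a} {b} _ _ _ _ _ =
    subst₂ (λ x y → _≤Q_ k (x , y) (a , b)) (sym (ℤₚ.+-identityʳ a)) (sym (ℤₚ.+-identityʳ b)) ε
  descend (suc i) j {a} {b} {d} a-b 1≤d d≤K j<d+i d+i≤K+j with d <? 2 * k + 2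
  ... | yes d<K =
    subst (λ x → _≤Q_ k (x , b ℤ.+ + j) (a , b)) (ℤₚ.+-assoc a (+ 1) (+ i))
      (descend i j a+1-b (s≤s z≤n) d<K (subst (suc j ≤_) (+-suc d i) j<d+i) (subst (_≤ 2 * k + 2 + j) (+-suc d i) d+i≤K+j)
       ◅◅ (stepA a b (from (InQ⇔ a b a-b) (1≤d , d≤K)) (from (InQ⇔ (a ℤ.+ + 1) b a+1-b) (s≤s z≤n , d<K)) ◅ ε))
    where
    a+1-b : a ℤ.+ + 1 ℤ.- b ≡ + suc d
    a+1-b = trans ([x+1]-y≡[x-y]+1 a b) (trans (cong (ℤ._+ + 1) a-b) (cong +_ (+-comm d 1)))
  descend (suc i) zero {d = d} _ _ _ _ d+i≤K | no d≮K =
    contradiction (<-≤-trans (m<m+n d (s≤s z≤n)) (subst (d + suc i ≤_) (+-identityʳ _) d+i≤K)) (≤⇒≯ (≮⇒≥ d≮K))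
  descend (suc i) (suc j) {a} {b} {suc d} a-b (s≤s z≤n) d≤K j<d+i d+i≤K+j | no d≮K =
    subst (λ y → _≤Q_ k (a ℤ.+ + suc i , y) (a , b)) (ℤₚ.+-assoc b (+ 1) (+ j))
      (descend (suc i) j a-[b+1] 1≤d d≤K′ (≤-pred j<d+i) (≤-pred (subst (suc (d + suc i) ≤_) (+-suc (2 * k + 2) j) d+i≤K+j))
       ◅◅ (stepB a b (from (InQ⇔ a b a-b) (s≤s z≤n , d≤K)) (from (InQ⇔ a (b ℤ.+ + 1) a-[b+1]) (1≤d , d≤K′)) ◅ ε))
    where
    a-[b+1] : a ℤ.- (b ℤ.+ + 1) ≡ + d
    a-[b+1] = trans (x-[y+1]≡[x-y]-1 a b) (cong (ℤ._- + 1) a-b)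
    1≤d : 1 ≤ d
    1≤d = ≤-pred (≤-trans (m≤n+m 2 (2 * k)) (≮⇒≥ d≮K))
    d≤K′ : d ≤ 2 * k + 2
    d≤K′ = ≤-trans (n≤1+n d) d≤K
  descend zero (suc j) {a} {b} {suc d} a-b _ d≤K j<d+i d+i≤K+j =
    subst (λ y → _≤Q_ k (a ℤ.+ + 0 , y) (a , b)) (ℤₚ.+-assoc b (+ 1) (+ j))
      (descend zero j a-[b+1] 1≤d d≤K′ (≤-pred j<d+i) (≤-pred (subst (suc (d + 0) ≤_) (+-suc (2 * k + 2) j) d+i≤K+j))
       ◅◅ (stepB a b (from (InQ⇔ a b a-b) (s≤s z≤n , d≤K)) (from (InQ⇔ a (b ℤ.+ + 1) a-[b+1]) (1≤d , d≤K′)) ◅ ε))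
    where
    a-[b+1] : a ℤ.- (b ℤ.+ + 1) ≡ + d
    a-[b+1] = trans (x-[y+1]≡[x-y]-1 a b) (cong (ℤ._- + 1) a-b)
    1≤d : 1 ≤ d
    1≤d = ≤-trans (s≤s z≤n) (≤-pred (subst (suc (suc j) ≤_) (+-identityʳ (suc d)) j<d+i))
    d≤K′ : d ≤ 2 * k + 2
    d≤K′ = ≤-trans (n≤1+n d) d≤K

  ≤Q-of-≤ : ∀ {a b a′ b′} → InQ k (a , b) → InQ k (a′ , b′) → a ℤ.≤ a′ → b ℤ.≤ b′ → _≤Q_ k (a′ , b′) (a , b)
  ≤Q-of-≤ {a} {b} {a′} {b′} qab qa′b′ a≤a′ b≤b′ with ≤⇒∃+ a≤a′ | ≤⇒∃+ b≤b′
    | InQ⇒diff a b qab | InQ⇒diff a′ b′ qa′b′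
  ... | i , refl | j , refl | d , a-b | d′ , a′-b′ =
    descend i j a-b 1≤d d≤K (subst (suc j ≤_) d′+j≡d+i (+-monoˡ-≤ j 1≤d′))
      (subst (_≤ 2 * k + 2 + j) d′+j≡d+i (+-monoˡ-≤ j d′≤K))
    where
    1≤d = proj₁ (to (InQ⇔ a b a-b) qab)
    d≤K = proj₂ (to (InQ⇔ a b a-b) qab)
    1≤d′ = proj₁ (to (InQ⇔ (a ℤ.+ + i) (b ℤ.+ + j) a′-b′) qa′b′)
    d′≤K = proj₂ (to (InQ⇔ (a ℤ.+ + i) (b ℤ.+ + j) a′-b′) qa′b′)
    shift : ∀ x y u v → x ℤ.+ u ℤ.- (y ℤ.+ v) ℤ.+ v ≡ x ℤ.- y ℤ.+ u
    shift = ℤ-Solver.solve-∀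
    d′+j≡d+i : d′ + j ≡ d + i
    d′+j≡d+i = ℤₚ.+-injective (begin
      + d′ ℤ.+ + j                          ≡⟨ cong (ℤ._+ + j) a′-b′ ⟨
      a ℤ.+ + i ℤ.- (b ℤ.+ + j) ℤ.+ + j     ≡⟨ shift a b (+ i) (+ j) ⟩
      a ℤ.- b ℤ.+ + i                       ≡⟨ cong (ℤ._+ + i) a-b ⟩
      + d ℤ.+ + i                           ∎)
      where open ≡-Reasoning

  upward : ∀ {J} → IsIdealQ k J → ∀ {a b a′ b′} → J (a , b) ≡ true → InQ k (a′ , b′) →
           a ℤ.≤ a′ → b ℤ.≤ b′ → J (a′ , b′) ≡ true
  upward (J⊆Q , closed) Jab q′ a≤a′ b≤b′ = closed _ _ q′ (J⊆Q _ Jab) Jab (≤Q-of-≤ (J⊆Q _ Jab) q′ a≤a′ b≤b′)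

  InQ⇒a≤b+K : ∀ {a b} → InQ k (a , b) → a ℤ.≤ b ℤ.+ + (2 * k + 2)
  InQ⇒a≤b+K {a} {b} (_ , a-b≤K) = subst₂ ℤ._≤_ (x-y+y≡x a b) (ℤₚ.+-comm (+ (2 * k + 2)) b) (ℤₚ.+-monoˡ-≤ b a-b≤K)

  InQ-ℕ : ∀ {a b} → InQ k (+ a , + b) ⇔ (b < a × a ≤ 2 * k + 2 + b)
  InQ-ℕ = mk⇔ (λ (lo , hi) → to +o≤[+m]-[+n]⇔o+n≤m lo , to [+m]-[+n]≤+o⇔m≤o+n hi)
              (λ (lo , hi) → from +o≤[+m]-[+n]⇔o+n≤m lo , from [+m]-[+n]≤+o⇔m≤o+n hi)

  1≤2k+2 : 1 ≤ 2 * k + 2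
  1≤2k+2 = ≤-trans (s≤s z≤n) (m≤n+m 2 (2 * k))

  diagonal∈Q : ∀ {D} → 1 ≤ D → D ≤ 2 * k + 2 → ∀ b → InQ k (+ (b + D) , + b)
  diagonal∈Q {D} 1≤D D≤K b =
    from InQ-ℕ (subst (_≤ b + D) (+-comm b 1) (+-monoʳ-≤ b 1≤D) , ≤-trans (+-monoʳ-≤ b D≤K) (≤-reflexive (+-comm b _)))

  InQ⁻⇒ℕ² : ∀ {a b} → InQ⁻ k (a , b) → ∃[ m ] ∃[ m′ ] ((a , b) ≡ (+ m , + m′))
  InQ⁻⇒ℕ² {a} {+ m′} (q , _) with InQ⇒diff a (+ m′) q
  ... | d , a-b = d + m′ , m′ , cong (_, + m′) (trans (sym (x-y+y≡x a (+ m′))) (cong (ℤ._+ + m′) a-b))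
  InQ⁻⇒ℕ² {a} { -[1+ t ] } (q , 2k+1≤a+b) with InQ⇒diff a -[1+ t ] q
  ... | d , a-b = contradiction (≤-trans 2k+3+2t≤d d≤K)
      (<⇒≱ (subst (_< 2 * k + 1 + suc (suc (t + t))) (+-assoc (2 * k) 1 1) (+-monoʳ-< (2 * k + 1) (s≤s (s≤s z≤n)))))
    where
    d≤K : d ≤ 2 * k + 2
    d≤K = proj₂ (to (InQ⇔ a -[1+ t ] a-b) q)
    a+b≡d⊖ : a ℤ.+ -[1+ t ] ≡ + d ℤ.- + suc (suc (t + t))
    a+b≡d⊖ = begin
      a ℤ.+ -[1+ t ]                           ≡⟨ cong (ℤ._+ -[1+ t ]) (sym (x-y+y≡x a -[1+ t ])) ⟩
      a ℤ.- -[1+ t ] ℤ.+ -[1+ t ] ℤ.+ -[1+ t ] ≡⟨ cong (λ w → w ℤ.+ -[1+ t ] ℤ.+ -[1+ t ]) a-b ⟩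
      + d ℤ.+ -[1+ t ] ℤ.+ -[1+ t ]            ≡⟨ x+[y+y]≡[x+y]+y (+ d) -[1+ t ] ⟨
      + d ℤ.- + suc (suc (t + t))              ∎
      where open ≡-Reasoning
    2k+3+2t≤d : 2 * k + 1 + suc (suc (t + t)) ≤ d
    2k+3+2t≤d = to +o≤[+m]-[+n]⇔o+n≤m (subst (+ (2 * k + 1) ℤ.≤_) a+b≡d⊖ 2k+1≤a+b)

  InQ⇒InQ⁺⊎InQ⁻ : ∀ a b → InQ k (a , b) → InQ⁺ k (a , b) ⊎ InQ⁻ k (a , b)
  InQ⇒InQ⁺⊎InQ⁻ a b q with a ℤ.+ b ℤₚ.≤? + (2 * k)
  ... | yes s≤2k = inj₁ (q , s≤2k)
  ... | no  s≰2k = inj₂ (q , subst (ℤ._≤ a ℤ.+ b) (cong +_ (+-comm 1 (2 * k))) (ℤₚ.i<j⇒suc[i]≤j (ℤₚ.≰⇒> s≰2k)))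

  Q⁺∩Q⁻≡∅ : ∀ {q} → InQ⁺ k q → InQ⁻ k q → ⊥
  Q⁺∩Q⁻≡∅ (_ , s≤2k) (_ , 2k+1≤s) = ℤₚ.<⇒≱ (ℤ.+<+ (subst (2 * k <_) (+-comm 1 (2 * k)) (n<1+n (2 * k))))
    (ℤₚ.≤-trans 2k+1≤s s≤2k)

  QStep⇒InQ : ∀ {x y} → QStep k x y → InQ k x
  QStep⇒InQ (stepA _ _ _ qx) = qx
  QStep⇒InQ (stepB _ _ _ qx) = qx

  QStep-InQ⁻ : ∀ {x y} → QStep k x y → InQ⁻ k y → InQ⁻ k x
  QStep-InQ⁻ (stepA a b _ qx) (_ , s) = qx , ℤₚ.≤-trans s (ℤₚ.+-monoˡ-≤ b (i≤i+1 a))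
  QStep-InQ⁻ (stepB a b _ qx) (_ , s) = qx , ℤₚ.≤-trans s (ℤₚ.+-monoʳ-≤ a (i≤i+1 b))

  fL-step : ∀ {x w} → QStep k x (fL k w) → ∃[ w′ ] (x ≡ fL k w′ × _≤P_ k w′ w)
  fL-step {w = m , m′} (stepA _ _ _ _) = (m + 1 , m′) , refl , m≤m+n m 1 , ≤-refl
  fL-step {w = m , m′} (stepB _ _ _ _) = (m , m′ + 1) , refl , ≤-refl , m≤m+n m′ 1

  fR≡⇔ : ∀ {a b u v} → fR k (a , b) ≡ (+ u , + v) ⇔ (u + b ≡ 3 * k + 1 × v + suc a ≡ k)
  fR≡⇔ {a} {b} {u} {v} = mk⇔
    (λ e → sym ([+m]-[+n]≡+o⇒m≡o+n (cong proj₁ e)) ,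
           sym ([+m]-[+n]≡+o⇒m≡o+n (trans (sym (x-y-z≡x-[y+z] (+ k) (+ 1) (+ a))) (cong proj₂ e))))
    (λ (e₁ , e₂) → cong₂ _,_ (m≡o+n⇒[+m]-[+n]≡+o (sym e₁))
                             (trans (x-y-z≡x-[y+z] (+ k) (+ 1) (+ a)) (m≡o+n⇒[+m]-[+n]≡+o (sym e₂))))

  fR⁻¹ : ℤ² → ℕ²
  fR⁻¹ (u , v) = ∣ + k ℤ.- + 1 ℤ.- v ∣ , ∣ + (3 * k + 1) ℤ.- u ∣

  fR⁻¹∘fR : ∀ x → fR⁻¹ (fR k x) ≡ x
  fR⁻¹∘fR (a , b) = cong₂ _,_ (cong ∣_∣ (x-[x-y]≡y (+ k ℤ.- + 1) (+ a))) (cong ∣_∣ (x-[x-y]≡y (+ (3 * k + 1)) (+ b)))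

  fR-injective : ∀ {x y} → fR k x ≡ fR k y → x ≡ y
  fR-injective {x} {y} e = trans (sym (fR⁻¹∘fR x)) (trans (cong fR⁻¹ e) (fR⁻¹∘fR y))

  fR₂≢k+t : ∀ {a b t} → proj₂ (fR k (a , b)) ≢ + (k + t)
  fR₂≢k+t {a} {b} {t} e = m+1+n≢m k (sym (begin
    k                 ≡⟨ [+m]-[+n]≡+o⇒m≡o+n (trans (sym (x-y-z≡x-[y+z] (+ k) (+ 1) (+ a))) e) ⟩
    k + t + suc a     ≡⟨ +-assoc k t (suc a) ⟩
    k + (t + suc a)   ≡⟨ cong (_+_ k) (+-suc t a) ⟩
    k + suc (t + a)   ∎))
    where open ≡-Reasoning

  fR∈Q⁻⇔ : ∀ {a b u v} → fR k (a , b) ≡ (+ u , + v) → InQ⁻ k (+ u , + v) ⇔ (a ≤ b × a + b < 2 * k)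
  fR∈Q⁻⇔ {a} {b} {u} {v} e = mk⇔
    (λ (q , s) → to bound₁ (proj₂ (to InQ-ℕ q)) , to bound₂ (ℤₚ.drop‿+≤+ s))
    (λ (a≤b , a+b<2k) → from InQ-ℕ (v<u (from bound₂ a+b<2k) , from bound₁ a≤b) , ℤ.+≤+ (from bound₂ a+b<2k))
    where
    e₁ = proj₁ (to (fR≡⇔ {a} {b}) e)
    e₂ = proj₂ (to (fR≡⇔ {a} {b}) e)
    bound₁ : u ≤ 2 * k + 2 + v ⇔ a ≤ b
    bound₁ = m+n≡o+p⇒o≤m⇔n≤p (suc-injective (begin
      suc (2 * k + 2 + v + a)   ≡⟨ lemma (2 * k + 2) v a ⟩
      2 * k + 2 + (v + suc a)   ≡⟨ cong (_+_ (2 * k + 2)) e₂ ⟩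
      2 * k + 2 + k             ≡⟨ lemma′ k ⟩
      suc (3 * k + 1)           ≡⟨ cong suc e₁ ⟨
      suc (u + b)               ∎))
      where
      open ≡-Reasoning
      lemma : ∀ K v a → suc (K + v + a) ≡ K + (v + suc a)
      lemma = solve-∀
      lemma′ : ∀ k → 2 * k + 2 + k ≡ suc (3 * k + 1)
      lemma′ = solve-∀
    bound₂ : 2 * k + 1 ≤ u + v ⇔ suc (a + b) ≤ 2 * k
    bound₂ = m+n≡o+p⇒o≤m⇔n≤p (begin
      u + v + suc (a + b)       ≡⟨ lemma u v a b ⟩
      (u + b) + (v + suc a)     ≡⟨ cong₂ _+_ e₁ e₂ ⟩
      3 * k + 1 + k             ≡⟨ lemma′ k ⟩
      2 * k + 1 + 2 * k         ∎)
      where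
      open ≡-Reasoning
      lemma : ∀ u v a b → u + v + suc (a + b) ≡ (u + b) + (v + suc a)
      lemma = solve-∀
      lemma′ : ∀ k → 3 * k + 1 + k ≡ 2 * k + 1 + 2 * k
      lemma′ = solve-∀
    v<u : 2 * k + 1 ≤ u + v → v < u
    v<u 2k+1≤u+v = ≰⇒> λ u≤v → <⇒≱ (≤-trans (+-mono-< v<k v<k) (≤-reflexive (lemma k)))
        (≤-trans (m≤m+n (2 * k) 1) (≤-trans 2k+1≤u+v (+-monoˡ-≤ v u≤v)))
      where
      v<k : v < k
      v<k = ≤-trans (m≤m+n (suc v) a) (≤-reflexive (trans (sym (+-suc v a)) e₂))
      lemma : ∀ k → k + k ≡ 2 * k
      lemma = solve-∀

  fR-onto : ∀ {u v} → InQ k (+ u , + v) → v < k → ∃[ z ] (fR k z ≡ (+ u , + v))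
  fR-onto {u} {v} q v<k =
    let (a , v+1+a≡k) = m≤n⇒∃[o]m+o≡n v<k
        (b , u+b≡3k+1) = m≤n⇒∃[o]m+o≡n u≤3k+1
    in (a , b) , from fR≡⇔ (u+b≡3k+1 , trans (+-suc v a) v+1+a≡k)
    where
    u≤3k+1 : u ≤ 3 * k + 1
    u≤3k+1 = ≤-trans (proj₂ (to InQ-ℕ q))
      (≤-trans (≤-reflexive (lemma k v)) (≤-trans (+-monoʳ-≤ (2 * k + 1) v<k) (≤-reflexive (lemma′ k))))
      where
      lemma : ∀ k v → 2 * k + 2 + v ≡ 2 * k + 1 + suc v
      lemma = solve-∀
      lemma′ : ∀ k → 2 * k + 1 + k ≡ 3 * k + 1
      lemma′ = solve-∀

  fR-step : ∀ {x y z} → QStep k x y → fR k z ≡ x → ∃[ z′ ] (fR k z′ ≡ y × _≤P_ k z′ z)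
  fR-step {z = z₁ , z₂} (stepA a b _ _) e = (z₁ , suc z₂) , cong₂ _,_ fst (cong proj₂ e) , ≤-refl , n≤1+n z₂
    where
    open ≡-Reasoning
    fst : + (3 * k + 1) ℤ.- + suc z₂ ≡ a
    fst = begin
      + (3 * k + 1) ℤ.- + suc z₂          ≡⟨ x-[1+y]≡x-y-1 (+ (3 * k + 1)) (+ z₂) ⟩
      + (3 * k + 1) ℤ.- + z₂ ℤ.- + 1      ≡⟨ cong (ℤ._- + 1) (cong proj₁ e) ⟩
      a ℤ.+ + 1 ℤ.- + 1                   ≡⟨ x+1-1≡x a ⟩
      a                                   ∎
  fR-step {z = z₁ , z₂} (stepB a b _ _) e = (suc z₁ , z₂) , cong₂ _,_ (cong proj₁ e) snd , n≤1+n z₁ , ≤-refl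
    where
    open ≡-Reasoning
    snd : + k ℤ.- + 1 ℤ.- + suc z₁ ≡ b
    snd = begin
      + k ℤ.- + 1 ℤ.- + suc z₁            ≡⟨ x-[1+y]≡x-y-1 (+ k ℤ.- + 1) (+ z₁) ⟩
      + k ℤ.- + 1 ℤ.- + z₁ ℤ.- + 1        ≡⟨ cong (ℤ._- + 1) (cong proj₂ e) ⟩
      b ℤ.+ + 1 ℤ.- + 1                   ≡⟨ x+1-1≡x b ⟩
      b                                   ∎

  fR-antitone : ∀ {x y} → _≤P_ k x y → proj₁ (fR k x) ℤ.≤ proj₁ (fR k y) × proj₂ (fR k x) ℤ.≤ proj₂ (fR k y)
  fR-antitone {a₁ , b₁} {a₀ , b₀} (a₀≤a₁ , b₀≤b₁) =
    minus-antitone (+ (3 * k + 1)) b₀≤b₁ , minus-antitone (+ k ℤ.- + 1) a₀≤a₁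
    where
    minus-antitone : ∀ c {m n} → m ≤ n → c ℤ.- + n ℤ.≤ c ℤ.- + m
    minus-antitone c m≤n = ℤₚ.+-monoʳ-≤ c (ℤₚ.neg-mono-≤ (ℤ.+≤+ m≤n))

  private
    k+1+2k : ∀ {i} → i ≤ 2 * k → k + 1 + ((2 * k ∸ i) + i) ≡ 3 * k + 1
    k+1+2k {i} i≤2k = trans (cong (_+_ (k + 1)) (m∸n+n≡m i≤2k)) (lemma k)
      where
      lemma : ∀ k → k + 1 + 2 * k ≡ 3 * k + 1
      lemma = solve-∀

  -- f_R(r i) covers both f_L(l i) and f_L(l (i + 1)) in Q: the source of the two admissibility conditions.
  fR-r≡l+e₁ : ∀ {i} → 1 ≤ i → i ≤ k → fR k (r k i) ≡ (+ (k + i) ℤ.+ + 1 , + (k ∸ i))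
  fR-r≡l+e₁ {i@(suc _)} _ i≤k = from fR≡⇔
    (trans (lemma k i (2 * k ∸ i)) (k+1+2k (≤-trans i≤k (m≤m+n k _))) , m∸n+n≡m i≤k)
    where
    lemma : ∀ k i w → k + i + 1 + w ≡ k + 1 + (w + i)
    lemma = solve-∀

  fR-r≡l+e₂ : ∀ {i} → 1 ≤ i → i < k → fR k (r k i) ≡ (+ (k + suc i) , + (k ∸ suc i) ℤ.+ + 1)
  fR-r≡l+e₂ {i@(suc _)} _ i<k = from fR≡⇔
    (trans (lemma k i (2 * k ∸ i)) (k+1+2k (≤-trans (<⇒≤ i<k) (m≤m+n k _))) , trans (lemma′ (k ∸ suc i) i) (m∸n+n≡m i<k))
    where
    lemma : ∀ k i w → k + suc i + w ≡ k + 1 + (w + i)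
    lemma = solve-∀
    lemma′ : ∀ w i → w + 1 + i ≡ w + suc i
    lemma′ = solve-∀

  L-antidiagonal : ∀ {a b} → b < a → a + b ≡ 2 * k → ∃[ i ] (1 ≤ i × i ≤ k × (a , b) ≡ l k i)
  L-antidiagonal {a} {b} b<a a+b≡2k =
    let (o , k+1+o≡a) = m≤n⇒∃[o]m+o≡n k<a
        a≡k+i : a ≡ k + suc o
        a≡k+i = trans (sym k+1+o≡a) (sym (+-suc k o))
        i+b≡k : suc o + b ≡ k
        i+b≡k = +-cancelˡ-≡ k _ _ (begin
          k + (suc o + b)    ≡⟨ +-assoc k (suc o) b ⟨
          k + suc o + b      ≡⟨ cong (_+ b) a≡k+i ⟨
          a + b              ≡⟨ a+b≡2k ⟩
          2 * k              ≡⟨ 2k≡k+k k ⟩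
          k + k              ∎)
    in suc o , s≤s z≤n , subst (suc o ≤_) i+b≡k (m≤m+n (suc o) b) ,
       cong₂ _,_ a≡k+i (trans (sym (m+n∸m≡n (suc o) b)) (cong (_∸ suc o) i+b≡k))
    where
    open ≡-Reasoning
    k<a : k < a
    k<a = ≰⇒> λ a≤k → <⇒≱ (+-mono-≤-< a≤k (<-≤-trans b<a a≤k)) (≤-reflexive (trans (sym (2k≡k+k k)) (sym a+b≡2k)))

  fR-diagonal : ∀ {c t} → suc (c + t) ≡ k → fR k (c , c) ≡ (+ (t + (2 * k + 2)) , + t)
  fR-diagonal {c} {t} refl = from fR≡⇔ (lemma c t , lemma′ c t)
    where
    lemma : ∀ c t → t + (2 * suc (c + t) + 2) + c ≡ 3 * suc (c + t) + 1
    lemma = solve-∀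
    lemma′ : ∀ c t → t + suc c ≡ suc (c + t)
    lemma′ = solve-∀

  2k+1<t+K+t : ∀ t → 2 * k + 1 < t + (2 * k + 2) + t
  2k+1<t+K+t t = ≤-trans (m≤m+n _ (t + t)) (≤-reflexive (lemma k t))
    where
    lemma : ∀ k t → suc (2 * k + 1) + (t + t) ≡ t + (2 * k + 2) + t
    lemma = solve-∀

  height : ℕ → ℕ → ℤ
  height x y = + (2 * k + 1) ℤ.- + x ℤ.- + y

  height≡⊖ : ∀ x y → height x y ≡ (2 * k + 1) ⊖ (x + y)
  height≡⊖ x y = trans (x-y-z≡x-[y+z] (+ (2 * k + 1)) (+ x) (+ y)) (ℤₚ.[+m]-[+n]≡m⊖n (2 * k + 1) (x + y))

  height-antitone : ∀ x y x′ y′ → (height x y ℤ.≤ height x′ y′) ⇔ (x′ + y′ ≤ x + y)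
  height-antitone x y x′ y′ = mk⇔
    (λ le → ≮⇒≥ λ lt → ℤₚ.<⇒≱ (ℤₚ.⊖-monoʳ->-< (2 * k + 1) lt)
      (subst₂ ℤ._≤_ (height≡⊖ x y) (height≡⊖ x′ y′) le))
    (λ le → subst₂ ℤ._≤_ (sym (height≡⊖ x y)) (sym (height≡⊖ x′ y′)) (ℤₚ.⊖-monoʳ-≥-≤ (2 * k + 1) le))

  height<0 : ∀ {x y} → 2 * k + 1 < x + y → height x y ℤ.< + 0
  height<0 {x} {y} lt = subst₂ ℤ._<_ (sym (height≡⊖ x y)) (ℤₚ.n⊖n≡0 (2 * k + 1)) (ℤₚ.⊖-monoʳ->-< (2 * k + 1) lt)

  0≤height : ∀ {x y} → x + y ≤ 2 * k + 1 → + 0 ℤ.≤ height x y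
  0≤height {x} {y} le = subst₂ ℤ._≤_ (ℤₚ.n⊖n≡0 (2 * k + 1)) (sym (height≡⊖ x y)) (ℤₚ.⊖-monoʳ-≥-≤ (2 * k + 1) le)

  module _ {J : ℤ² → Bool} (J⊆ℕ² : ∀ q → J q ≡ true → ∃[ x ] ∃[ y ] (q ≡ (+ x , + y)))
           {p D : ℕ} (D+p≡K : D + p ≡ 2 * k + 2) where

    private
      diagonal⇔ : ∀ x y → (+ x ℤ.- + y ≡ + (2 * k + 2) ℤ.- + p) ⇔ (x ≡ y + D)
      diagonal⇔ x y = mk⇔
        (λ e → trans ([+m]-[+n]≡+o⇒m≡o+n {n = y} (trans e K-p≡D)) (+-comm D y))
        (λ e → trans (m≡o+n⇒[+m]-[+n]≡+o {n = y} (trans e (+-comm y D))) (sym K-p≡D))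
        where
        K-p≡D : + (2 * k + 2) ℤ.- + p ≡ + D
        K-p≡D = m≡o+n⇒[+m]-[+n]≡+o (sym D+p≡K)

      height-bound : ∀ {b₀} → (∀ b → J (+ (b + D) , + b) ≡ true → b₀ ≤ b) →
                     ∀ q → J q ≡ true → proj₁ q ℤ.- proj₂ q ≡ + (2 * k + 2) ℤ.- + p →
                     + (2 * k + 1) ℤ.- proj₁ q ℤ.- proj₂ q ℤ.≤ height (b₀ + D) b₀
      height-bound {b₀} least q Jq d with J⊆ℕ² q Jq
      ... | x , y , refl with to (diagonal⇔ x y) d
      ... | refl = from (height-antitone (y + D) y (b₀ + D) b₀) (from (m+d+m≤n+d+n⇔m≤n {d = D}) (least y Jq))

    HeightIs-of-threshold : ∀ {b₀} → (∀ b → J (+ (b + D) , + b) ≡ true ⇔ b₀ ≤ b) →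
                            HeightIs k J p (height (b₀ + D) b₀)
    HeightIs-of-threshold {b₀} char =
      ((+ (b₀ + D) , + b₀) , from (char b₀) ≤-refl , from (diagonal⇔ (b₀ + D) b₀) refl , refl) ,
      height-bound (λ b → to (char b))

    threshold-of-HeightIs : IsIdealQ k J → 1 ≤ D → ∀ {h} → HeightIs k J p h →
                            ∃[ b₀ ] ((∀ b → J (+ (b + D) , + b) ≡ true ⇔ b₀ ≤ b) × h ≡ height (b₀ + D) b₀)
    threshold-of-HeightIs ideal 1≤D (((qa , qb) , Jq , d , refl) , bounded) with J⊆ℕ² (qa , qb) Jq
    ... | x , y , refl with to (diagonal⇔ x y) d
    ... | refl = y , char , refl
      where
      char : ∀ b → J (+ (b + D) , + b) ≡ true ⇔ y ≤ b
      char b = mk⇔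
        (λ Jb → to (m+d+m≤n+d+n⇔m≤n {d = D}) (to (height-antitone (b + D) b (y + D) y) (bounded _ Jb (from (diagonal⇔ (b + D) b) refl))))
        (λ y≤b → upward ideal Jq (diagonal∈Q 1≤D (≤-trans (m≤m+n D p) (≤-reflexive D+p≡K)) b)
          (ℤ.+≤+ (+-monoˡ-≤ D y≤b)) (ℤ.+≤+ y≤b))

  balance⇔ : ∀ b₀ b₁ → (∣ height (b₀ + (2 * k + 2)) b₀ ℤ.+ height (b₁ + 1) b₁ ∣ ≡ 1)
             ⇔ (suc (b₀ + b₁) ≡ k ⊎ b₀ + b₁ ≡ k)
  balance⇔ b₀ b₁ = mk⇔
    (λ e → halve (to ∣m⊖n∣≡1⇔ (trans (sym (cong ∣_∣ sum≡)) e)))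
    (λ c → trans (cong ∣_∣ sum≡) (from ∣m⊖n∣≡1⇔ (unhalve c)))
    where
    open ≡-Reasoning
    S = b₀ + b₁
    c = 2 * k + 1
    sum≡ : height (b₀ + (2 * k + 2)) b₀ ℤ.+ height (b₁ + 1) b₁ ≡ 2 * k ⊖ suc (S + S)
    sum≡ = begin
      height (b₀ + (2 * k + 2)) b₀ ℤ.+ height (b₁ + 1) b₁
        ≡⟨ regroup (+ c) (+ (b₀ + (2 * k + 2))) (+ b₀) (+ (b₁ + 1)) (+ b₁) ⟩
      + (c + c) ℤ.- + (b₀ + (2 * k + 2) + b₀ + (b₁ + 1 + b₁))
        ≡⟨ ℤₚ.[+m]-[+n]≡m⊖n (c + c) (b₀ + (2 * k + 2) + b₀ + (b₁ + 1 + b₁)) ⟩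
      (c + c) ⊖ (b₀ + (2 * k + 2) + b₀ + (b₁ + 1 + b₁))
        ≡⟨ cong₂ _⊖_ (lemma k) (lemma′ k b₀ b₁) ⟩
      (2 * k + 2 + 2 * k) ⊖ (2 * k + 2 + suc (S + S))
        ≡⟨ ℤₚ.+-cancelˡ-⊖ (2 * k + 2) (2 * k) (suc (S + S)) ⟩
      2 * k ⊖ suc (S + S) ∎
      where
      regroup : ∀ C X Y X′ Y′ → (C ℤ.- X ℤ.- Y) ℤ.+ (C ℤ.- X′ ℤ.- Y′) ≡ (C ℤ.+ C) ℤ.- (X ℤ.+ Y ℤ.+ (X′ ℤ.+ Y′))
      regroup = ℤ-Solver.solve-∀
      lemma : ∀ k → (2 * k + 1) + (2 * k + 1) ≡ 2 * k + 2 + 2 * k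
      lemma = solve-∀
      lemma′ : ∀ k b₀ b₁ → b₀ + (2 * k + 2) + b₀ + (b₁ + 1 + b₁) ≡ 2 * k + 2 + suc (b₀ + b₁ + (b₀ + b₁))
      lemma′ = solve-∀
    halve : 2 * k ≡ suc (suc (S + S)) ⊎ suc (S + S) ≡ suc (2 * k) → suc S ≡ k ⊎ S ≡ k
    halve (inj₁ e) = inj₁ (*-cancelˡ-≡ (suc S) k 2 (trans (trans (2k≡k+k (suc S)) (cong suc (+-suc S S))) (sym e)))
    halve (inj₂ e) = inj₂ (*-cancelˡ-≡ S k 2 (trans (2k≡k+k S) (suc-injective e)))
    unhalve : suc S ≡ k ⊎ S ≡ k → 2 * k ≡ suc (suc (S + S)) ⊎ suc (S + S) ≡ suc (2 * k)
    unhalve (inj₁ refl) = inj₁ (trans (2k≡k+k (suc S)) (cong suc (+-suc S S)))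
    unhalve (inj₂ refl) = inj₂ (cong suc (sym (2k≡k+k S)))

  InL? : ∀ x → Dec (InL k x)
  InL? (a , b) = (_ ≤? _) ×-dec (b <? a) ×-dec (a + b ≤? 2 * k)

  InR? : ∀ x → Dec (InR k x)
  InR? (a , b) = (_ ≤? _) ×-dec (a ≤? b) ×-dec (a + b ≤? 2 * k ∸ 1)

  InQ? : ∀ q → Dec (InQ k q)
  InQ? (a , b) = (+ 1 ℤₚ.≤? a ℤ.- b) ×-dec (a ℤ.- b ℤₚ.≤? + (2 * k + 2))

  InQ⁻? : ∀ q → Dec (InQ⁻ k q)
  InQ⁻? (a , b) = InQ? (a , b) ×-dec (+ (2 * k + 1) ℤₚ.≤? a ℤ.+ b)

  ∈f? : (I : ℕ² → Bool) → ∀ q → Dec (_∈f[_] k q I)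
  ∈f? I q = preimage? (fL k) (λ (a , b) → ∣ a ∣ , ∣ b ∣) (λ _ → refl) ℤ²-≟ InL? I? q
            ⊎-dec (InQ⁻? q ×-dec ¬? (preimage? (fR k) (fR⁻¹) (fR⁻¹∘fR) ℤ²-≟ InR? I? q))
    where
    ℤ²-≟ = ≡-dec ℤₚ._≟_ ℤₚ._≟_
    I? : ∀ x → Dec (I x ≡ true)
    I? x = I x ≟ᵇ true

module _ (k : ℕ) (1≤k : 1 ≤ k) where

  private
    weight : ℕ → ℕ → ℕ
    weight a b = (2 * k + 1) * a + (2 * k + 3) * b

    weight≡ : ∀ a b → 2 + weight a b ≡ (2 * k + 1) * (a + b) + (suc b + suc b)
    weight≡ = lemma k
      where
      lemma : ∀ k a b → 2 + ((2 * k + 1) * a + (2 * k + 3) * b) ≡ (2 * k + 1) * (a + b) + (suc b + suc b)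
      lemma = solve-∀

    sq≡ : (2 * k + 1) * (2 * k) + suc (2 * k) ≡ (2 * k + 1) * (2 * k + 1)
    sq≡ = lemma k
      where
      lemma : ∀ k → (2 * k + 1) * (2 * k) + suc (2 * k) ≡ (2 * k + 1) * (2 * k + 1)
      lemma = solve-∀

    L-weight : ∀ {a b} → b < a → a + b ≤ 2 * k → 2 + weight a b ≤ (2 * k + 1) * (2 * k + 1)
    L-weight {a} {b} b<a a+b≤2k = begin
      2 + weight a b                          ≡⟨ weight≡ a b ⟩
      (2 * k + 1) * (a + b) + (suc b + suc b) ≤⟨ +-mono-≤ (*-monoʳ-≤ (2 * k + 1) a+b≤2k) (+-monoˡ-≤ (suc b) b<a) ⟩
      (2 * k + 1) * (2 * k) + (a + suc b)     ≤⟨ +-monoʳ-≤ _ (≤-trans (≤-reflexive (+-suc a b)) (s≤s a+b≤2k)) ⟩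
      (2 * k + 1) * (2 * k) + suc (2 * k)     ≡⟨ sq≡ ⟩
      (2 * k + 1) * (2 * k + 1)               ∎
      where open ≤-Reasoning

    R-weight : ∀ {a b} → a ≤ b → a + b < 2 * k → 2 + weight a b ≤ (2 * k + 1) * (2 * k + 1)
    R-weight {a} {b} a≤b a+b<2k = +-cancelʳ-≤ (2 * k + 1) _ _ (begin
      2 + weight a b + (2 * k + 1)                            ≡⟨ cong (_+ (2 * k + 1)) (weight≡ a b) ⟩
      (2 * k + 1) * (a + b) + (suc b + suc b) + (2 * k + 1)  
        ≤⟨ +-monoˡ-≤ (2 * k + 1) (+-monoʳ-≤ ((2 * k + 1) * (a + b)) (+-mono-≤ (s≤s b≤a+b) (s≤s b≤a+b))) ⟩
      (2 * k + 1) * (a + b) + (suc (a + b) + suc (a + b)) + (2 * k + 1) ≡⟨ lemma₁ k (a + b) ⟩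
      (2 * k + 3) * suc (a + b)                               ≤⟨ *-monoʳ-≤ (2 * k + 3) a+b<2k ⟩
      (2 * k + 3) * (2 * k)                                   ≤⟨ m≤m+n _ 2 ⟩
      (2 * k + 3) * (2 * k) + 2                               ≡⟨ lemma₂ k ⟩
      (2 * k + 1) * (2 * k + 1) + (2 * k + 1)                 ∎)
      where
      open ≤-Reasoning
      b≤a+b = m≤n+m b a
      lemma₁ : ∀ k s → (2 * k + 1) * s + (suc s + suc s) + (2 * k + 1) ≡ (2 * k + 3) * suc s
      lemma₁ = solve-∀
      lemma₂ : ∀ k → (2 * k + 3) * (2 * k) + 2 ≡ (2 * k + 1) * (2 * k + 1) + (2 * k + 1)
      lemma₂ = solve-∀

    overweight-sum : ∀ {a b} → 2 * k < a + b → (2 * k + 1) * (2 * k + 1) < 2 + weight a b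
    overweight-sum {a} {b} 2k<a+b = begin-strict
      (2 * k + 1) * (2 * k + 1)               <⟨ m<m+n _ (s≤s z≤n) ⟩
      (2 * k + 1) * (2 * k + 1) + suc (b + suc b) ≤⟨ +-monoˡ-≤ _ (*-monoʳ-≤ (2 * k + 1) (subst (_≤ a + b) (+-comm 1 (2 * k)) 2k<a+b)) ⟩
      (2 * k + 1) * (a + b) + (suc b + suc b) ≡⟨ weight≡ a b ⟨
      2 + weight a b                          ∎
      where open ≤-Reasoning

    overweight-diagonal : ∀ {a b} → 2 * k ≤ a + b → a ≤ b → (2 * k + 1) * (2 * k + 1) < 2 + weight a b
    overweight-diagonal {a} {b} 2k≤a+b a≤b = begin-strict
      (2 * k + 1) * (2 * k + 1)               ≡⟨ sq≡ ⟨
      (2 * k + 1) * (2 * k) + suc (2 * k)     <⟨ +-mono-≤-< (*-monoʳ-≤ (2 * k + 1) 2k≤a+b) (s≤s 2k<b+1+b) ⟩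
      (2 * k + 1) * (a + b) + (suc b + suc b) ≡⟨ weight≡ a b ⟨
      2 + weight a b                          ∎
      where
      open ≤-Reasoning
      2k<b+1+b : 2 * k < b + suc b
      2k<b+1+b = ≤-trans (s≤s (≤-trans 2k≤a+b (+-monoˡ-≤ b a≤b))) (≤-reflexive (sym (+-suc b b)))

  InP'⇔ : ∀ {a b} → InP' k (a , b) ⇔ (2 + weight a b ≤ (2 * k + 1) * (2 * k + 1))
  InP'⇔ = mk⇔
    (λ w≤F → ≤-trans (+-monoʳ-≤ 2 w≤F) (≤-reflexive (2+Frob≡[2k+1]² 1≤k)))
    (λ w≤F → +-cancelˡ-≤ 2 _ _ (≤-trans w≤F (≤-reflexive (sym (2+Frob≡[2k+1]² 1≤k)))))

  InL⇔ : ∀ {a b} → InL k (a , b) ⇔ (b < a × a + b ≤ 2 * k)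
  InL⇔ {a} {b} = mk⇔ proj₂ (λ (b<a , a+b≤2k) → from (InP'⇔ {a} {b}) (L-weight b<a a+b≤2k) , b<a , a+b≤2k)

  InR⇔ : ∀ {a b} → InR k (a , b) ⇔ (a ≤ b × a + b < 2 * k)
  InR⇔ {a} {b} = mk⇔
    (λ (_ , a≤b , a+b≤2k-1) → a≤b , m≤pred[n]⇒suc[m]≤n {{>-nonZero (≤-trans 1≤k (m≤m+n k _))}} a+b≤2k-1)
    (λ (a≤b , a+b<2k) → from (InP'⇔ {a} {b}) (R-weight a≤b a+b<2k) , a≤b , <⇒≤pred a+b<2k)

  InP'⇒InL⊎InR : ∀ {a b} → InP' k (a , b) → InL k (a , b) ⊎ InR k (a , b)
  InP'⇒InL⊎InR {a} {b} p with to InP'⇔ p | b <? a | a + b ≤? 2 * k | suc (a + b) ≤? 2 * k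
  ... | w≤F | _      | no  a+b≰2k | _ = contradiction w≤F (<⇒≱ (overweight-sum (≰⇒> a+b≰2k)))
  ... | _  | yes b<a | yes a+b≤2k | _ = inj₁ (p , b<a , a+b≤2k)
  ... | _  | no  b≮a | yes _      | yes a+b<2k = inj₂ (from InR⇔ (≮⇒≥ b≮a , a+b<2k))
  ... | w≤F | no b≮a | yes a+b≤2k | no a+b≮2k = contradiction w≤F (<⇒≱ (overweight-diagonal (≮⇒≥ a+b≮2k) (≮⇒≥ b≮a)))

  InL⇔fL∈Q⁺ : ∀ {a b} → InL k (a , b) ⇔ InQ⁺ k (fL k (a , b))
  InL⇔fL∈Q⁺ {a} {b} = mk⇔
    (λ il → let (b<a , a+b≤2k) = to InL⇔ il in
            from (InQ-ℕ k) (b<a , ≤-trans (m≤m+n a b) (≤-trans a+b≤2k (≤-trans (m≤m+n (2 * k) 2) (m≤m+n _ b)))) ,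
            ℤ.+≤+ a+b≤2k)
    (λ (q , a+b≤2k) → from InL⇔ (proj₁ (to (InQ-ℕ k) q) , ℤₚ.drop‿+≤+ a+b≤2k))

  fR-ℕ : ∀ {a b} → a < k → b ≤ 3 * k + 1 → ∃[ u ] ∃[ v ] (fR k (a , b) ≡ (+ u , + v))
  fR-ℕ {a} {b} a<k b≤3k+1 with m≤n⇒∃[o]m+o≡n a<k | m≤n⇒∃[o]m+o≡n b≤3k+1
  ... | v , a+1+v≡k | u , b+u≡3k+1 = u , v , from (fR≡⇔ k) (trans (+-comm u b) b+u≡3k+1 , trans (+-comm v (suc a)) a+1+v≡k)

  InR⇔fR∈Q⁻ : ∀ {a b} → InR k (a , b) ⇔ InQ⁻ k (fR k (a , b))
  InR⇔fR∈Q⁻ {a} {b} = mk⇔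
    (λ r → let (a≤b , a+b<2k) = to InR⇔ r
               (u , v , e) = fR-ℕ (a<k a≤b a+b<2k) (b≤3k+1 a+b<2k)
           in subst (InQ⁻ k) (sym e) (from ((fR∈Q⁻⇔ k) e) (a≤b , a+b<2k)))
    (λ q → let (u , v , e) = InQ⁻⇒ℕ² k q in from InR⇔ (to ((fR∈Q⁻⇔ k) e) (subst (InQ⁻ k) e q)))
    where
    a<k : a ≤ b → a + b < 2 * k → a < k
    a<k a≤b a+b<2k = ≰⇒> λ k≤a → <⇒≱ a+b<2k (≤-trans (≤-reflexive (2k≡k+k k)) (+-mono-≤ k≤a (≤-trans k≤a a≤b)))
    b≤3k+1 : a + b < 2 * k → b ≤ 3 * k + 1
    b≤3k+1 a+b<2k = ≤-trans (m≤n+m b a) (≤-trans (<⇒≤ a+b<2k) (≤-trans (m≤m+n (2 * k) (k + 1)) (≤-reflexive (lemma k))))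
      where
      lemma : ∀ k → 2 * k + (k + 1) ≡ 3 * k + 1
      lemma = solve-∀

  L∩R≡∅ : ∀ {x} → InL k x → InR k x → ⊥
  L∩R≡∅ (_ , b<a , _) (_ , a≤b , _) = <⇒≱ b<a a≤b

  L⇒b<k : ∀ {a b} → InL k (a , b) → b < k
  L⇒b<k {a} {b} lx = ≰⇒> λ k≤b → <⇒≱ (+-mono-<-≤ (≤-trans (s≤s k≤b) b<a) k≤b)
    (≤-trans a+b≤2k (≤-reflexive (2k≡k+k k)))
    where
    b<a = proj₁ (to InL⇔ lx)
    a+b≤2k = proj₂ (to InL⇔ lx)

  R⇒a<k : ∀ {a b} → InR k (a , b) → a < k
  R⇒a<k {a} {b} rx = ≰⇒> λ k≤a → <⇒≱ a+b<2k (≤-trans (≤-reflexive (2k≡k+k k)) (+-mono-≤ k≤a (≤-trans k≤a a≤b)))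
    where
    a≤b = proj₁ (to InR⇔ rx)
    a+b<2k = proj₂ (to InR⇔ rx)

  fL∈Q : ∀ {x} → InL k x → InQ k (fL k x)
  fL∈Q {a , b} lx = proj₁ (to InL⇔fL∈Q⁺ lx)

  fR∈Q : ∀ {x} → InR k x → InQ k (fR k x)
  fR∈Q {a , b} rx = proj₁ (to InR⇔fR∈Q⁻ rx)

  diagonal∈R : ∀ {c} → c < k → InR k (c , c)
  diagonal∈R c<k = from InR⇔ (≤-refl , ≤-trans (+-mono-< c<k c<k) (≤-reflexive (sym (2k≡k+k k))))

  subdiagonal∈L : ∀ {c} → c < k → InL k (c + 1 , c)
  subdiagonal∈L {c} c<k = from InL⇔
    (m<m+n c (s≤s z≤n) , ≤-trans (+-mono-≤ (subst (_≤ k) (+-comm 1 c) c<k) (<⇒≤ c<k)) (≤-reflexive (sym (2k≡k+k k))))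

  l∈L : ∀ {i} → 1 ≤ i → i ≤ k → InL k (l k i)
  l∈L {i} 1≤i i≤k = from InL⇔
    (≤-trans (s≤s (m∸n≤m k i)) (subst (_≤ k + i) (+-comm k 1) (+-monoʳ-≤ k 1≤i)) ,
     ≤-reflexive (trans (lemma k i (k ∸ i)) (trans (cong (_+_ k) (m∸n+n≡m i≤k)) (sym (2k≡k+k k)))))
    where
    lemma : ∀ k i w → k + i + w ≡ k + (w + i)
    lemma = solve-∀

  r∈R : ∀ {i} → 1 ≤ i → i ≤ k → InR k (r k i)
  r∈R {suc j} _ i≤k = from InR⇔ (j≤w , ≤-reflexive (trans (lemma j w) w+i≡2k))
    where
    w = 2 * k ∸ suc j
    w+i≡2k : w + suc j ≡ 2 * k
    w+i≡2k = m∸n+n≡m (≤-trans i≤k (≤-trans (m≤m+n k k) (≤-reflexive (sym (2k≡k+k k)))))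
    j≤w : j ≤ w
    j≤w = +-cancelʳ-≤ (suc j) j w (≤-trans (+-mono-≤ (≤-trans (n≤1+n j) i≤k) i≤k)
      (≤-reflexive (trans (sym (2k≡k+k k)) (sym w+i≡2k))))
    lemma : ∀ j w → suc (j + w) ≡ w + suc j
    lemma = solve-∀

module Forward (k : ℕ) (1≤k : 1 ≤ k) (I : ℕ² → Bool) (adm : Admissible k I) where

  private
    I⊆P' = proj₁ (proj₁ adm)
    I-closed′ = proj₂ (proj₁ adm)
    no-l-r = proj₁ (proj₂ adm)
    no-r-l = proj₂ (proj₂ adm)

  I-closed : ∀ {x y} → InP' k x → _≤P_ k x y → I y ≡ true → I x ≡ true
  I-closed {x} {y} px x≤y Iy = I-closed′ x y px (I⊆P' y Iy) Iy x≤y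

  _∈f : ℤ² → Set
  q ∈f = _∈f[_] k q I

  private
    on-antidiagonal : ∀ {m m′ s} → InL k (m , m′) → s ≡ suc (m + m′) → 2 * k + 1 ≤ s →
                      ∃[ i ] (1 ≤ i × i ≤ k × (m , m′) ≡ l k i)
    on-antidiagonal {m} {m′} il refl 2k+1≤s =
      L-antidiagonal k b<a (≤-antisym a+b≤2k (≤-pred (subst (_≤ suc (m + m′)) (+-comm (2 * k) 1) 2k+1≤s)))
      where
      b<a = proj₁ (to (InL⇔ k 1≤k) il)
      a+b≤2k = proj₂ (to (InL⇔ k 1≤k) il)

    sum≥2k+1 : ∀ {z x y} → InR k z → fR k z ≡ (+ x , + y) → 2 * k + 1 ≤ x + y
    sum≥2k+1 rz e = ℤₚ.drop‿+≤+ (proj₂ (subst (InQ⁻ k) e (to (InR⇔fR∈Q⁻ k 1≤k) rz)))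

  -- A cover of I ∩ L that leaves Q⁺ covers some l i; it is f_R(r i), or f_R(r (i - 1)) when i > 1,
  -- and admissibility keeps both out of f_R(I ∩ R).
  cover-of-L∉fR : ∀ {x m m′ z} → QStep k x (+ m , + m′) → InL k (m , m′) → I (m , m′) ≡ true →
                  InR k z → I z ≡ true → fR k z ≡ x → ⊥
  cover-of-L∉fR {m = m} {m′} (stepA _ _ _ _) il Iw rz Iz e with on-antidiagonal il (trans (+-assoc m 1 m′) (+-suc m m′)) (sum≥2k+1 rz e)
  ... | i , 1≤i , i≤k , refl = no-l-r i 1≤i i≤k
    (Iw , subst (λ w → I w ≡ true) (fR-injective k (trans e (sym (fR-r≡l+e₁ k 1≤i i≤k)))) Iz)
  cover-of-L∉fR {m = m} {m′} {z₁ , z₂} (stepB _ _ _ _) il Iw rz Iz e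
    with on-antidiagonal il (trans (cong (_+_ m) (+-comm m′ 1)) (+-suc m m′)) (sum≥2k+1 rz e)
  ... | suc zero , _ , _ , refl = fR₂≢k+t k {z₁} {z₂} {0}
    (trans (cong proj₂ e) (cong +_ (trans (m∸n+n≡m 1≤k) (sym (+-identityʳ k)))))
  ... | suc (suc j) , _ , i≤k , refl = no-r-l (suc j) (s≤s z≤n) i≤k
    (subst (λ w → I w ≡ true) (fR-injective k (trans e (sym (fR-r≡l+e₂ k (s≤s z≤n) i≤k)))) Iz , Iw)

  ∈f-step : ∀ {x y} → QStep k x y → y ∈f → x ∈f
  ∈f-step st (inj₁ (w , il , Iw , refl)) with fL-step k st
  ... | w′@(a′ , b′) , refl , w′≤w with InQ⇒InQ⁺⊎InQ⁻ k (+ a′) (+ b′) (QStep⇒InQ k st)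
  ...   | inj₁ x⁺ = let il′ = from (InL⇔fL∈Q⁺ k 1≤k) x⁺ in inj₁ (w′ , il′ , I-closed (proj₁ il′) w′≤w Iw , refl)
  ...   | inj₂ x⁻ = inj₂ (x⁻ , λ (z , rz , Iz , e) → cover-of-L∉fR st il Iw rz Iz e)
  ∈f-step st (inj₂ (y⁻ , ∉fR)) = inj₂ (QStep-InQ⁻ k st y⁻ , λ (z , rz , Iz , e) →
    let (z′ , e′ , z′≤z) = fR-step k st e
        rz′ = from (InR⇔fR∈Q⁻ k 1≤k) (subst (InQ⁻ k) (sym e′) y⁻)
    in ∉fR (z′ , rz′ , I-closed (proj₁ rz′) z′≤z Iz , e′))

  ∈f⇒InQ : ∀ q → q ∈f → InQ k q
  ∈f⇒InQ _ (inj₁ ((a , b) , il , _ , refl)) = proj₁ (to (InL⇔fL∈Q⁺ k 1≤k) il)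
  ∈f⇒InQ _ (inj₂ (q⁻ , _)) = proj₁ q⁻

  ∈f⇒ℕ² : ∀ q → q ∈f → ∃[ x ] ∃[ y ] (q ≡ (+ x , + y))
  ∈f⇒ℕ² _ (inj₁ ((a , b) , _ , _ , refl)) = a , b , refl
  ∈f⇒ℕ² _ (inj₂ (q⁻ , _)) = InQ⁻⇒ℕ² k q⁻

  J : ℤ² → Bool
  J q = does (∈f? k I q)

  J⇔∈f : ∀ q → J q ≡ true ⇔ q ∈f
  J⇔∈f q = does≡true⇔ (∈f? k I q)

  J-ideal : IsIdealQ k J
  J-ideal = (λ q Jq → ∈f⇒InQ q (to (J⇔∈f q) Jq)) , λ x y _ _ Jy x≤y → from (J⇔∈f x) (∈f-star x≤y (to (J⇔∈f y) Jy))
    where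
    ∈f-star : ∀ {x y} → _≤Q_ k x y → y ∈f → x ∈f
    ∈f-star ε y∈f = y∈f
    ∈f-star (st ◅ x≤y) y∈f = ∈f-step st (∈f-star x≤y y∈f)

  private
    diagonal-threshold = threshold k (λ c → I (c , c))
      (λ c c+1<k Icc → I-closed (proj₁ (diagonal∈R k 1≤k c+1<k)) (n≤1+n c , n≤1+n c) Icc)
    subdiagonal-threshold = threshold k (λ c → I (c + 1 , c))
      (λ c c+1<k Ic → I-closed (proj₁ (subdiagonal∈L k 1≤k c+1<k)) (+-monoˡ-≤ 1 (n≤1+n c) , n≤1+n c) Ic)

  γ = proj₁ diagonal-threshold
  γ≤k = proj₁ (proj₂ diagonal-threshold)
  γ-char : ∀ c → c < k → I (c , c) ≡ true ⇔ γ ≤ c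
  γ-char = proj₂ (proj₂ diagonal-threshold)

  δ = proj₁ subdiagonal-threshold
  δ≤k = proj₁ (proj₂ subdiagonal-threshold)
  δ-char : ∀ c → c < k → I (c + 1 , c) ≡ true ⇔ δ ≤ c
  δ-char = proj₂ (proj₂ subdiagonal-threshold)

  δ≤γ : δ ≤ γ
  δ≤γ = decide (γ <? k)
    where
    decide : Dec (γ < k) → δ ≤ γ
    decide (yes γ<k) = to (δ-char γ γ<k)
      (I-closed {γ + 1 , γ} {γ , γ} (proj₁ (subdiagonal∈L k 1≤k γ<k)) (m≤m+n γ 1 , ≤-refl) (from (γ-char γ γ<k) ≤-refl))
    decide (no γ≮k) = ≤-trans δ≤k (≮⇒≥ γ≮k)

  γ≤δ+1 : γ ≤ δ + 1
  γ≤δ+1 = decide (δ + 1 <? k)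
    where
    decide : Dec (δ + 1 < k) → γ ≤ δ + 1
    decide (yes δ+1<k) = to (γ-char (δ + 1) δ+1<k)
      (I-closed {δ + 1 , δ + 1} {δ + 1 , δ} (proj₁ (diagonal∈R k 1≤k δ+1<k)) (≤-refl , m≤m+n δ 1)
        (from (δ-char δ (<-trans (m<m+n δ (s≤s z≤n)) δ+1<k)) ≤-refl))
    decide (no δ+1≮k) = ≤-trans γ≤k (≮⇒≥ δ+1≮k)

  t₀ : ℕ
  t₀ = k ∸ γ

  private
    complement : ∀ {t} → t < k → ∃[ c ] (suc (c + t) ≡ k)
    complement {t} t<k = let (c , t+1+c≡k) = m≤n⇒∃[o]m+o≡n t<k in c , trans (cong suc (+-comm c t)) t+1+c≡k

    γ≤c⇔t<t₀ : ∀ {c t} → suc (c + t) ≡ k → γ ≤ c ⇔ t < t₀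
    γ≤c⇔t<t₀ {c} {t} e = m+n≡o+p⇒o≤m⇔n≤p (trans (+-suc c t) (trans e (sym (m+[n∸m]≡n γ≤k))))

  diagonal₀ : ∀ t → (+ (t + (2 * k + 2)) , + t) ∈f ⇔ t₀ ≤ t
  diagonal₀ t = mk⇔ to′ from′
    where
    to′ : (+ (t + (2 * k + 2)) , + t) ∈f → t₀ ≤ t
    to′ (inj₁ (_ , il , _ , refl)) = contradiction (proj₂ (to (InL⇔ k 1≤k) il))
      (<⇒≱ (<-trans (m<m+n (2 * k) (s≤s z≤n)) (2k+1<t+K+t k t)))
    to′ (inj₂ (_ , ∉fR)) = ≮⇒≥ λ t<t₀ →
      let (c , e) = complement (<-≤-trans t<t₀ (m∸n≤m k γ))
          c<k = ≤-trans (s≤s (m≤m+n c t)) (≤-reflexive e)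
      in ∉fR ((c , c) , diagonal∈R k 1≤k c<k , from (γ-char c c<k) (from (γ≤c⇔t<t₀ e) t<t₀) , fR-diagonal k e)
    from′ : t₀ ≤ t → (+ (t + (2 * k + 2)) , + t) ∈f
    from′ t₀≤t = inj₂ ((diagonal∈Q k (1≤2k+2 k) ≤-refl t , ℤ.+≤+ (<⇒≤ (2k+1<t+K+t k t))) , ∉fR)
      where
      ∉fR : ¬ (∃[ z ] (InR k z × I z ≡ true × fR k z ≡ (+ (t + (2 * k + 2)) , + t)))
      ∉fR ((z₁ , z₂) , rz , Iz , e) = by-cases (t <? k)
        where
        by-cases : Dec (t < k) → ⊥
        by-cases (no t≮k) = let (t′ , k+t′≡t) = m≤n⇒∃[o]m+o≡n (≮⇒≥ t≮k)
          in fR₂≢k+t k {z₁} {z₂} (trans (cong proj₂ e) (cong +_ (sym k+t′≡t)))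
        by-cases (yes t<k) =
          let (c , e′) = complement t<k
              c<k = ≤-trans (s≤s (m≤m+n c t)) (≤-reflexive e′)
              z≡cc = fR-injective k (trans e (sym (fR-diagonal k e′)))
          in <⇒≱ (to (γ≤c⇔t<t₀ e′) (to (γ-char c c<k) (subst (λ w → I w ≡ true) z≡cc Iz))) t₀≤t

  diagonal₁ : ∀ c → (+ (c + 1) , + c) ∈f ⇔ δ ≤ c
  diagonal₁ c = by-cases (c <? k)
    where
    when-c<k : c < k → (+ (c + 1) , + c) ∈f → δ ≤ c
    when-c<k c<k (inj₁ (_ , _ , Iw , refl)) = to (δ-char c c<k) Iw
    when-c<k c<k (inj₂ ((_ , 2k+1≤s) , _)) = contradiction (ℤₚ.drop‿+≤+ 2k+1≤s)
      (<⇒≱ (≤-trans (s≤s (proj₂ (to (InL⇔ k 1≤k) (subdiagonal∈L k 1≤k c<k)))) (≤-reflexive (+-comm 1 (2 * k)))))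

    when-k≤c : k ≤ c → InQ⁻ k (+ (c + 1) , + c) × ¬ (∃[ z ] (InR k z × I z ≡ true × fR k z ≡ (+ (c + 1) , + c)))
    when-k≤c k≤c =
      (diagonal∈Q k ≤-refl (1≤2k+2 k) c ,
       ℤ.+≤+ (≤-trans (≤-reflexive (lemma k)) (+-mono-≤ (+-monoˡ-≤ 1 k≤c) k≤c))) ,
      λ ((z₁ , z₂) , _ , _ , e) → let (t , k+t≡c) = m≤n⇒∃[o]m+o≡n k≤c
        in fR₂≢k+t k {z₁} {z₂} (trans (cong proj₂ e) (cong +_ (sym k+t≡c)))
      where
      lemma : ∀ k → 2 * k + 1 ≡ k + 1 + k
      lemma = solve-∀

    by-cases : Dec (c < k) → (+ (c + 1) , + c) ∈f ⇔ δ ≤ c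
    by-cases (yes c<k) = mk⇔ (when-c<k c<k) (λ δ≤c → inj₁ ((c + 1 , c) , subdiagonal∈L k 1≤k c<k , from (δ-char c c<k) δ≤c , refl))
    by-cases (no c≮k) = mk⇔ (λ _ → ≤-trans δ≤k (≮⇒≥ c≮k)) (λ _ → inj₂ (when-k≤c (≮⇒≥ c≮k)))

  J⊆ℕ² : ∀ q → J q ≡ true → ∃[ x ] ∃[ y ] (q ≡ (+ x , + y))
  J⊆ℕ² q Jq = ∈f⇒ℕ² q (to (J⇔∈f q) Jq)

  J-balanced : IsBalanced k J
  J-balanced =
    J-ideal ,
    ((+ 0 , -[1+ 0 ]) , (ℤ.+≤+ (s≤s z≤n) , ℤ.+≤+ (1≤2k+2 k)) , ¬-not λ Jq → q₀∉ℕ² (J⊆ℕ² _ Jq)) ,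
    ((+ (δ + 1) , + δ) , from (J⇔∈f _) (from (diagonal₁ δ) ≤-refl)) ,
    (height k (t₀ + (2 * k + 2)) t₀ , height k (δ + 1) δ ,
     HeightIs-of-threshold k J⊆ℕ² {0} {2 * k + 2} (+-identityʳ _) (λ t → ⇔-trans (J⇔∈f _) (diagonal₀ t)) ,
     HeightIs-of-threshold k J⊆ℕ² {2 * k + 1} {1} (trans (+-comm 1 (2 * k + 1)) (+-assoc (2 * k) 1 1))
      (λ c → ⇔-trans (J⇔∈f _) (diagonal₁ c)) ,
     height<0 k {t₀ + (2 * k + 2)} {t₀} (2k+1<t+K+t k t₀) ,
     0≤height k {δ + 1} {δ} (≤-trans (+-mono-≤ (+-monoˡ-≤ 1 δ≤k) δ≤k) (≤-reflexive (lemma k))) ,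
     from (balance⇔ k t₀ δ) balance)
    where
    q₀∉ℕ² : ¬ (∃[ x ] ∃[ y ] ((+ 0 , -[1+ 0 ]) ≡ (+ x , + y)))
    q₀∉ℕ² (_ , _ , ())
    lemma : ∀ k → k + 1 + k ≡ 2 * k + 1
    lemma = solve-∀
    balance : suc (t₀ + δ) ≡ k ⊎ t₀ + δ ≡ k
    balance = from-γ (m≤n⇒m<n∨m≡n γ≤δ+1)
      where
      γ+t₀≡k : γ + t₀ ≡ k
      γ+t₀≡k = m+[n∸m]≡n γ≤k
      from-γ : γ < δ + 1 ⊎ γ ≡ δ + 1 → suc (t₀ + δ) ≡ k ⊎ t₀ + δ ≡ k
      from-γ (inj₁ γ<δ+1) = inj₂ (trans (+-comm t₀ δ)
        (trans (cong (_+ t₀) (sym (≤-antisym (≤-pred (subst (γ <_) (+-comm δ 1) γ<δ+1)) δ≤γ))) γ+t₀≡k))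
      from-γ (inj₂ γ≡δ+1) = inj₁ (trans (lemma′ t₀ δ) (trans (cong (_+ t₀) (sym γ≡δ+1)) γ+t₀≡k))
        where
        lemma′ : ∀ t δ → suc (t + δ) ≡ δ + 1 + t
        lemma′ = solve-∀

  J-represents : Represents k I J
  J-represents q = to (J⇔∈f q) , from (J⇔∈f q)

module _ (k : ℕ) (1≤k : 1 ≤ k) where

  module _ {I I′ : ℕ² → Bool} (adm : Admissible k I) (same-image : ∀ q → _∈f[_] k q I ⇔ _∈f[_] k q I′) where

    f-reflects : ∀ x → I x ≡ true → I′ x ≡ true
    f-reflects x@(a , b) Ix with InP'⇒InL⊎InR k 1≤k (proj₁ (proj₁ adm) x Ix)
    ... | inj₁ lx with to (same-image (fL k x)) (inj₁ (x , lx , Ix , refl))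
    ...   | inj₁ (w , _ , I′w , e) = subst (λ w → I′ w ≡ true) (cong (λ (a , b) → ∣ a ∣ , ∣ b ∣) e) I′w
    ...   | inj₂ (q⁻ , _) = ⊥-elim (Q⁺∩Q⁻≡∅ k {fL k x} (to (InL⇔fL∈Q⁺ k 1≤k) lx) q⁻)
    f-reflects x@(a , b) Ix | inj₂ rx = ¬-not λ I′x≡false → fRx∉f[I] (from (same-image (fR k x)) (inj₂ (fRx⁻ , λ (z , _ , I′z , e) →
      contradiction (trans (sym (subst (λ w → I′ w ≡ true) (fR-injective k e) I′z)) I′x≡false) λ ())))
      where
      fRx⁻ = to (InR⇔fR∈Q⁻ k 1≤k) rx
      fRx∉f[I] : ¬ (_∈f[_] k (fR k x) I)
      fRx∉f[I] (inj₁ ((c , d) , lw , _ , e)) = Q⁺∩Q⁻≡∅ k {fR k x} (subst (InQ⁺ k) e (to (InL⇔fL∈Q⁺ k 1≤k) lw)) fRx⁻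
      fRx∉f[I] (inj₂ (_ , ∉fR)) = ∉fR (x , rx , Ix , refl)

  f-injective : ∀ I I′ → Admissible k I → Admissible k I′ → ∀ J → Represents k I J → Represents k I′ J →
                ∀ x → I x ≡ I′ x
  f-injective I I′ adm adm′ J rep rep′ x = ⇔→≡ (mk⇔ (f-reflects adm same x) (f-reflects adm′ (λ q → ⇔-sym (same q)) x))
    where
    same : ∀ q → _∈f[_] k q I ⇔ _∈f[_] k q I′
    same q = mk⇔ (λ q∈ → proj₁ (rep′ q) (proj₂ (rep q) q∈)) (λ q∈ → proj₁ (rep q) (proj₂ (rep′ q) q∈))

module Backward (k : ℕ) (1≤k : 1 ≤ k) (J : ℤ² → Bool) (bal : IsBalanced k J) where

  private
    J-ideal = proj₁ bal
    heights = proj₂ (proj₂ (proj₂ bal))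
    H₀ = proj₁ (proj₂ (proj₂ heights))
    H₁ = proj₁ (proj₂ (proj₂ (proj₂ heights)))
    h₀<0 = proj₁ (proj₂ (proj₂ (proj₂ (proj₂ heights))))
    |h₀+h₁|≡1 = proj₂ (proj₂ (proj₂ (proj₂ (proj₂ (proj₂ heights)))))

  J⊆ℕ² : ∀ q → J q ≡ true → ∃[ x ] ∃[ y ] (q ≡ (+ x , + y))
  J⊆ℕ² (a , + y) Jq =
    let (d , a-b) = InQ⇒diff k a (+ y) (proj₁ J-ideal _ Jq)
    in d + y , y , cong (_, + y) (trans (sym (x-y+y≡x a (+ y))) (cong (ℤ._+ + y) a-b))
  -- If b < 0, J contains (b + 2k + 2 , b), whose height -2b - 1 > 0 on the diagonal p = 0 contradicts h₀ < 0.
  J⊆ℕ² (a , -[1+ t ]) Jq = ⊥-elim (ℤₚ.<⇒≱ h₀<0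
    (ℤₚ.≤-trans (ℤ.+≤+ z≤n) (subst (ℤ._≤ _) height≡ (proj₂ H₀ p Jp diagonal))))
    where
    b = -[1+ t ]
    p = (b ℤ.+ + (2 * k + 2) , b)
    K≡ : + (2 * k + 2) ≡ + (2 * k + 1) ℤ.+ + 1
    K≡ = cong +_ (sym (+-assoc (2 * k) 1 1))
    height≡ : + (2 * k + 1) ℤ.- (b ℤ.+ + (2 * k + 2)) ℤ.- b ≡ + suc (t + t)
    height≡ = trans (cong (λ K → + (2 * k + 1) ℤ.- (b ℤ.+ K) ℤ.- b) K≡) (lemma (+ (2 * k + 1)) b)
      where
      lemma : ∀ c b → c ℤ.- (b ℤ.+ (c ℤ.+ + 1)) ℤ.- b ≡ ℤ.- (b ℤ.+ b) ℤ.- + 1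
      lemma = ℤ-Solver.solve-∀
    diagonal : b ℤ.+ + (2 * k + 2) ℤ.- b ≡ + (2 * k + 2) ℤ.- + 0
    diagonal = trans (x+y-x≡y b (+ (2 * k + 2))) (sym (ℤₚ.+-identityʳ _))
    Jp : J p ≡ true
    Jp = upward k J-ideal Jq (from (InQ⇔ k (b ℤ.+ + (2 * k + 2)) b (x+y-x≡y b _)) (1≤2k+2 k , ≤-refl))
           (InQ⇒a≤b+K k {a} {b} (proj₁ J-ideal _ Jq)) ℤₚ.≤-refl

  private
    B₀-threshold = threshold-of-HeightIs k J⊆ℕ² {0} {2 * k + 2} (+-identityʳ _) J-ideal (1≤2k+2 k) H₀
    B₁-threshold = threshold-of-HeightIs k J⊆ℕ² {2 * k + 1} {1} (trans (+-comm 1 (2 * k + 1)) (+-assoc (2 * k) 1 1)) J-ideal ≤-refl H₁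

  B₀ = proj₁ B₀-threshold
  diagonal₀ : ∀ t → J (+ (t + (2 * k + 2)) , + t) ≡ true ⇔ B₀ ≤ t
  diagonal₀ = proj₁ (proj₂ B₀-threshold)

  B₁ = proj₁ B₁-threshold
  diagonal₁ : ∀ c → J (+ (c + 1) , + c) ≡ true ⇔ B₁ ≤ c
  diagonal₁ = proj₁ (proj₂ B₁-threshold)

  balance : suc (B₀ + B₁) ≡ k ⊎ B₀ + B₁ ≡ k
  balance = to (balance⇔ k B₀ B₁)
    (subst₂ (λ h h′ → ∣ h ℤ.+ h′ ∣ ≡ 1) (proj₂ (proj₂ B₀-threshold)) (proj₂ (proj₂ B₁-threshold)) |h₀+h₁|≡1)

  B₀+B₁≤k : B₀ + B₁ ≤ k
  B₀+B₁≤k = [ (λ e → ≤-trans (n≤1+n _) (≤-reflexive e)) , ≤-reflexive ]′ balance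

  k≤1+B₀+B₁ : k ≤ suc (B₀ + B₁)
  k≤1+B₀+B₁ = [ ≤-reflexive ∘ sym , (λ e → ≤-trans (≤-reflexive (sym e)) (n≤1+n _)) ]′ balance

  diagonal₀∌⇒diagonal₁∋ : ∀ {c t} → suc (c + t) ≡ k → J (+ (t + (2 * k + 2)) , + t) ≡ false → J (+ (c + 1) , + c) ≡ true
  diagonal₀∌⇒diagonal₁∋ {c} {t} e J≡false = from (diagonal₁ c) (+-cancelˡ-≤ (suc t) B₁ c (begin
    suc t + B₁   ≤⟨ +-monoˡ-≤ B₁ t<B₀ ⟩
    B₀ + B₁      ≤⟨ B₀+B₁≤k ⟩
    k            ≡⟨ e ⟨
    suc (c + t)  ≡⟨ cong suc (+-comm c t) ⟩
    suc t + c    ∎))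
    where
    open ≤-Reasoning
    t<B₀ : t < B₀
    t<B₀ = ≰⇒> λ B₀≤t → contradiction (trans (sym (from (diagonal₀ t) B₀≤t)) J≡false) λ ()

  diagonal₁∋⇒diagonal₀∌ : ∀ {c t} → suc (c + 1 + t) ≡ k → J (+ (c + 1) , + c) ≡ true → J (+ (t + (2 * k + 2)) , + t) ≡ false
  diagonal₁∋⇒diagonal₀∌ {c} {t} e Jc = ¬-not λ Jt → <-irrefl refl (begin-strict
    k                   ≤⟨ k≤1+B₀+B₁ ⟩
    suc (B₀ + B₁)       ≤⟨ s≤s (+-mono-≤ (to (diagonal₀ t) Jt) (to (diagonal₁ c) Jc)) ⟩
    suc (t + c)         <⟨ s≤s (≤-reflexive (lemma c t)) ⟩
    suc (c + 1 + t)     ≡⟨ e ⟩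
    k                   ∎)
    where
    open ≤-Reasoning
    lemma : ∀ c t → suc (t + c) ≡ c + 1 + t
    lemma = solve-∀

  I : ℕ² → Bool
  I x with InL? k x | InR? k x
  ... | yes _ | _     = J (fL k x)
  ... | no  _ | yes _ = not (J (fR k x))
  ... | no  _ | no  _ = false

  I-L : ∀ {x} → InL k x → I x ≡ J (fL k x)
  I-L {x} lx with InL? k x
  ... | yes _   = refl
  ... | no  ¬lx = contradiction lx ¬lx

  I-R : ∀ {x} → InR k x → I x ≡ not (J (fR k x))
  I-R {x} rx with InL? k x | InR? k x
  ... | yes lx | _     = ⊥-elim (L∩R≡∅ k 1≤k lx rx)
  ... | no  _  | yes _ = refl
  ... | no  _  | no ¬rx = contradiction rx ¬rx

  I⊆P' : ∀ x → I x ≡ true → InP' k x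
  I⊆P' x Ix with InL? k x | InR? k x
  ... | yes lx | _      = proj₁ lx
  ... | no  _  | yes rx = proj₁ rx
  ... | no  _  | no  _  = contradiction Ix λ ()

  private
    J-fR≡false : ∀ {x} → InR k x → I x ≡ true → J (fR k x) ≡ false
    J-fR≡false rx Ix = trans (sym (not-involutive _)) (cong not (trans (sym (I-R rx)) Ix))

    J-fR-downward : ∀ {x y} → InR k x → InR k y → _≤P_ k x y → J (fR k y) ≡ false → J (fR k x) ≡ false
    J-fR-downward {x} {y} rx ry x≤y J≡false = ¬-not λ Jx → contradiction
      (trans (sym (upward k J-ideal Jx (fR∈Q k 1≤k ry) (proj₁ (fR-antitone k x≤y)) (proj₂ (fR-antitone k x≤y)))) J≡false) λ ()

    -- Goes through the diagonal points (c + 1 , c) ∈ J and f_R(c + 1 , c + 1) ∉ J.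
    L-below-R : ∀ {x y} → InR k x → InL k y → _≤P_ k x y → J (fL k y) ≡ true → J (fR k x) ≡ false
    L-below-R {a₁ , b₁} {suc c , b₀} rx ly (1+c≤a₁ , b₀≤b₁) Jy =
      J-fR-downward rx (diagonal∈R k 1≤k c+1<k) (c+1≤a₁ , ≤-trans c+1≤a₁ (proj₁ (to (InR⇔ k 1≤k) rx))) J-diagonal≡false
      where
      c+1≤a₁ : c + 1 ≤ a₁
      c+1≤a₁ = ≤-trans (≤-reflexive (+-comm c 1)) 1+c≤a₁
      c+1<k : c + 1 < k
      c+1<k = ≤-<-trans c+1≤a₁ (R⇒a<k k 1≤k rx)
      Jc : J (+ (c + 1) , + c) ≡ true
      Jc = upward k J-ideal Jy (diagonal∈Q k ≤-refl (1≤2k+2 k) c)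
             (ℤ.+≤+ (≤-reflexive (+-comm 1 c))) (ℤ.+≤+ (≤-pred (proj₁ (to (InL⇔ k 1≤k) ly))))
      J-diagonal≡false : J (fR k (c + 1 , c + 1)) ≡ false
      J-diagonal≡false = let (t , e) = m≤n⇒∃[o]m+o≡n c+1<k in trans (cong J (fR-diagonal k e)) (diagonal₁∋⇒diagonal₀∌ e Jc)

    -- Dually, through f_R(b₀ , b₀) and (b₀ + 1 , b₀).
    R-below-L : ∀ {x y} → InL k x → InR k y → _≤P_ k x y → J (fR k y) ≡ false → J (fL k x) ≡ true
    R-below-L {a₁ , b₁} {a₀ , b₀} lx ry (a₀≤a₁ , b₀≤b₁) J≡false =
      let b₀<k = ≤-<-trans b₀≤b₁ (L⇒b<k k 1≤k lx)
          (t , e) = m≤n⇒∃[o]m+o≡n b₀<k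
          Jb₀ = diagonal₀∌⇒diagonal₁∋ e (trans (cong J (sym (fR-diagonal k e)))
                  (J-fR-downward (diagonal∈R k 1≤k b₀<k) ry (proj₁ (to (InR⇔ k 1≤k) ry) , ≤-refl) J≡false))
      in upward k J-ideal Jb₀ (fL∈Q k 1≤k lx)
           (ℤ.+≤+ (≤-trans (≤-reflexive (+-comm b₀ 1)) (≤-<-trans b₀≤b₁ (proj₁ (to (InL⇔ k 1≤k) lx)))))
           (ℤ.+≤+ b₀≤b₁)

  I-closed : ∀ x y → InP' k x → InP' k y → I y ≡ true → _≤P_ k x y → I x ≡ true
  I-closed x@(a₁ , b₁) y@(a₀ , b₀) px py Iy x≤y@(a₀≤a₁ , b₀≤b₁) =
    by-cases (InP'⇒InL⊎InR k 1≤k px) (InP'⇒InL⊎InR k 1≤k py)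
    where
    by-cases : InL k x ⊎ InR k x → InL k y ⊎ InR k y → I x ≡ true
    by-cases (inj₁ lx) (inj₁ ly) = trans (I-L lx)
      (upward k J-ideal (trans (sym (I-L ly)) Iy) (fL∈Q k 1≤k lx) (ℤ.+≤+ a₀≤a₁) (ℤ.+≤+ b₀≤b₁))
    by-cases (inj₁ lx) (inj₂ ry) = trans (I-L lx) (R-below-L lx ry x≤y (J-fR≡false ry Iy))
    by-cases (inj₂ rx) (inj₁ ly) = trans (I-R rx) (cong not (L-below-R rx ly x≤y (trans (sym (I-L ly)) Iy)))
    by-cases (inj₂ rx) (inj₂ ry) = trans (I-R rx) (cong not (J-fR-downward rx ry x≤y (J-fR≡false ry Iy)))

  I-admissible : Admissible k I
  I-admissible = (I⊆P' , I-closed) , no-l-r , no-r-l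
    where
    not-both : ∀ {x z} → InL k x → InR k z → I x ≡ true → I z ≡ true →
               proj₁ (fL k x) ℤ.≤ proj₁ (fR k z) → proj₂ (fL k x) ℤ.≤ proj₂ (fR k z) → ⊥
    not-both lx rz Ix Iz a≤ b≤ =
      contradiction (trans (sym (upward k J-ideal (trans (sym (I-L lx)) Ix) (fR∈Q k 1≤k rz) a≤ b≤)) (J-fR≡false rz Iz)) λ ()
    no-l-r : ∀ i → 1 ≤ i → i ≤ k → ¬ (I (l k i) ≡ true × I (r k i) ≡ true)
    no-l-r i 1≤i i≤k (Il , Ir) = not-both (l∈L k 1≤k 1≤i i≤k) (r∈R k 1≤k 1≤i i≤k) Il Ir
      (ℤₚ.≤-trans (ℤ.+≤+ (m≤m+n _ 1)) (ℤₚ.≤-reflexive (sym (cong proj₁ e)))) (ℤₚ.≤-reflexive (sym (cong proj₂ e)))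
      where e = fR-r≡l+e₁ k 1≤i i≤k
    no-r-l : ∀ i → 1 ≤ i → i < k → ¬ (I (r k i) ≡ true × I (l k (suc i)) ≡ true)
    no-r-l i 1≤i i<k (Ir , Il) = not-both (l∈L k 1≤k (s≤s z≤n) i<k) (r∈R k 1≤k 1≤i (<⇒≤ i<k)) Il Ir
      (ℤₚ.≤-reflexive (sym (cong proj₁ e))) (ℤₚ.≤-trans (ℤ.+≤+ (m≤m+n _ 1)) (ℤₚ.≤-reflexive (sym (cong proj₂ e))))
      where e = fR-r≡l+e₂ k 1≤i i<k

  I-represents : Represents k I J
  I-represents q = J⇒∈f q , ∈f⇒J q
    where
    J⇒∈f : ∀ q → J q ≡ true → _∈f[_] k q I
    J⇒∈f q Jq with J⊆ℕ² q Jq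
    ... | x , y , refl = by-cases (InQ⇒InQ⁺⊎InQ⁻ k (+ x) (+ y) (proj₁ J-ideal _ Jq))
      where
      by-cases : InQ⁺ k (+ x , + y) ⊎ InQ⁻ k (+ x , + y) → _∈f[_] k (+ x , + y) I
      by-cases (inj₁ q⁺) = let lx = from (InL⇔fL∈Q⁺ k 1≤k) q⁺ in inj₁ ((x , y) , lx , trans (I-L lx) Jq , refl)
      by-cases (inj₂ q⁻) = inj₂ (q⁻ , λ (z , rz , Iz , e) →
        contradiction (trans (sym Iz) (trans (I-R rz) (cong not (trans (cong J e) Jq)))) λ ())
    ∈f⇒J : ∀ q → _∈f[_] k q I → J q ≡ true
    ∈f⇒J _ (inj₁ (w , lw , Iw , refl)) = trans (sym (I-L lw)) Iw
    ∈f⇒J (qa , qb) (inj₂ (q⁻ , ∉fR)) with InQ⁻⇒ℕ² k {qa} {qb} q⁻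
    ... | u , v , refl = by-cases (v <? k)
      where
      by-cases : Dec (v < k) → J (+ u , + v) ≡ true
      by-cases (no v≮k) = upward k J-ideal (from (diagonal₁ B₁) ≤-refl) (proj₁ q⁻)
        (ℤ.+≤+ (≤-trans (≤-reflexive (+-comm B₁ 1)) (≤-<-trans B₁≤v (proj₁ (to (InQ-ℕ k) (proj₁ q⁻)))))) (ℤ.+≤+ B₁≤v)
        where
        B₁≤v = ≤-trans (m+n≤o⇒n≤o B₀ B₀+B₁≤k) (≮⇒≥ v≮k)
      by-cases (yes v<k) =
        let ((a , b) , e) = fR-onto k (proj₁ q⁻) v<k
            rz = from (InR⇔fR∈Q⁻ k 1≤k) (subst (InQ⁻ k) (sym e) q⁻)
        in ¬-not λ J≡false → ∉fR ((a , b) , rz , trans (I-R rz) (cong not (trans (cong J e) J≡false)) , e)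

  f-surjective : ∃[ I ] (Admissible k I × Represents k I J)
  f-surjective = I , I-admissible , I-represents

theorem3p13 : (k : ℕ) → 1 ≤ k →
    -- f maps admissible ideals of P' to balanced order ideals of Q
    ((I : ℕ² → Bool) → Admissible k I →
      ∃[ J ] (IsBalanced k J × Represents k I J))
    -- f is injective
    × ((I I' : ℕ² → Bool) → Admissible k I → Admissible k I' →
       (J : ℤ² → Bool) → Represents k I J → Represents k I' J →
       ∀ x → I x ≡ I' x)
    -- f is surjective
    × ((J : ℤ² → Bool) → IsBalanced k J →
       ∃[ I ] (Admissible k I × Represents k I J))
theorem3p13 k 1≤k =
  (λ I adm → let open Forward k 1≤k I adm in J , J-balanced , J-represents) ,
  f-injective k 1≤k ,
  (λ J bal → Backward.f-surjective k 1≤k J bal)
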